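{- Let $\mathcal{A}=\{A_0,A_1,A_2\}$ be the standard basis of a symmetric rank $3$ standard integral table algebra (e.g. the adjacency matrices of the association scheme of a strongly regular graph), with character table $$\begin{bmatrix}1&k&\ell\\ 1&r&-1-r\\ 1&s&-1-s\end{bmatrix},\qquad r\ge s .$$ (1) Let $\tau$ be a partition of $\{2,\dots,9\}$ each of whose blocks is a union of blocks of $2|3|456|789$. Then $\tau$ gives a fusion of $\mathcal{A}\otimes\mathcal{A}$ for every such $\mathcal{A}$ if and only if $\tau\in\{2|3|456|789,\ 2|3|456789,\ 23|456|789,\ 23|456789,\ 23456789\}$. For any other such $\tau$, $\tau$ gives a fusion of $\mathcal{A}\otimes\mathcal{A}$ if and only if either $k=r$, $s=-1$ and $\tau\in\{2|3456789,\ 23456|789,\ 2|3456|789\}$, or $\ell=-1-s$, $r=0$ and $\tau\in\{2456789|3,\ 23789|456,\ 2789|3|456\}$. (2) Let $\tau$ be a partition of $\{2,\dots,9\}$ each of whose blocks is a union of blocks of $258|369|4|7$. Then $\tau$ gives a fusion of $\mathcal{A}\otimes\mathcal{A}$ for every such $\mathcal{A}$ if and only if $\tau\in\{258|369|4|7,\ 258|369|47,\ 235689|4|7,\ 235689|47,\ 23456789\}$. For any other such $\tau$, $\tau$ gives a fusion if and only if either $k=r$, $s=-1$ and $\tau\in\{2356789|4,\ 24578|369,\ 2578|369|4\}$, or $\ell=-1-s$, $r=0$ and $\tau\in\{2345689|7,\ 258|34679,\ 258|3469|7\}$.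
   Context: A symmetric rank $3$ standard integral table algebra is a commutative associative complex algebra with basis $A_0=1,A_1,A_2$ such that the structure constants $\lambda_{ijh}$ ($A_iA_j=\sum_h\lambda_{ijh}A_h$) are nonnegative reals, $\lambda_{ij0}=0$ for $i\neq j$, and $\lambda_{ii0}=\delta(A_i)$ is a positive integer, where $\delta$ is the valency homomorphism $\delta(A_i)=\lambda_{ii0}$. Main example: $A_0=I_n$, $A_1$ the adjacency matrix of a strongly regular graph (neither complete nor edgeless), $A_2=J-I-A_1$. Set $k=\delta(A_1)$, $\ell=\delta(A_2)$; the character table has rows the characters $\chi_0=\delta,\chi_1,\chi_2$ and columns $A_0,A_1,A_2$. The tensor square $\mathcal{A}\otimes\mathcal{A}$ has basis $A_{ij}=A_i\otimes A_j$, relabelled $C_{3j+i+1}=A_{ij}$: $C_1=A_{00},C_2=A_{10},C_3=A_{20},C_4=A_{01},C_5=A_{11},C_6=A_{21},C_7=A_{02},C_8=A_{12},C_9=A_{22}$. Partitions of $\{2,\dots,9\}$ are written with blocks separated by bars. A partition $\tau$ gives a fusion of $\mathcal{A}\otimes\mathcal{A}$ if the span of $C_1$ and the block sums $\sum_{t\in T}C_t$ ($T$ a block of $\tau$) is closed under multiplication. (The partition $2|3|456|789$ corresponds to the wreath product $(\mathcal{A}\otimes1)\wr(1\otimes\mathcal{A})$ and $258|369|4|7$ to $(1\otimes\mathcal{A})\wr(\mathcal{A}\otimes 1)$.) -}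

module Defs where

open import Level using (0ℓ)
open import Data.Nat as ℕ using (ℕ; zero; suc)
open import Data.Fin using (Fin; zero; suc)
open import Data.Fin.Properties using () renaming (_≟_ to _≟ᶠ_)
open import Data.Bool using (Bool; true; false; if_then_else_)
open import Data.Product using (Σ; ∃; _×_; _,_; proj₁; proj₂)
open import Data.Sum using (_⊎_)
open import Data.List using (List; []; _∷_)
open import Data.List.Relation.Unary.Any using (Any)
open import Data.Vec using (Vec; []; _∷_; lookup)
open import Relation.Binary.PropositionalEquality using (_≡_; _≢_)
open import Relation.Binary.Structures using (IsTotalOrder)
open import Relation.Nullary.Decidable using (⌊_⌋)
open import Algebra.Structures using (IsCommutativeRing)

-- The real numbers, axiomatised as a complete ordered field
-- (unique up to isomorphism; agda-stdlib has no ℝ).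

record RealField : Set₁ where
  infixl 6 _+_
  infixl 7 _*_
  infix 4 _≤_ _<_
  field
    Carrier : Set
    _+_ _*_ : Carrier → Carrier → Carrier
    -_      : Carrier → Carrier
    0# 1#   : Carrier
    isCommutativeRing : IsCommutativeRing _≡_ _+_ _*_ -_ 0# 1#
    0≢1     : 0# ≢ 1#
    inverse : ∀ x → x ≢ 0# → ∃ λ y → x * y ≡ 1#
    _≤_     : Carrier → Carrier → Set
    isTotalOrder : IsTotalOrder _≡_ _≤_
    +-mono-≤ : ∀ {x y} z → x ≤ y → x + z ≤ y + z
    *-nonneg : ∀ {x y} → 0# ≤ x → 0# ≤ y → 0# ≤ x * y
    complete : (P : Carrier → Set) → ∃ P → (∃ λ b → ∀ x → P x → x ≤ b) →
               ∃ λ u → (∀ x → P x → x ≤ u) ×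
                       (∀ b → (∀ x → P x → x ≤ b) → u ≤ b)

  _<_ : Carrier → Carrier → Set
  x < y = x ≤ y × x ≢ y

  fromℕ : ℕ → Carrier
  fromℕ zero    = 0#
  fromℕ (suc n) = 1# + fromℕ n

  sum : ∀ {n} → (Fin n → Carrier) → Carrier
  sum {zero}  f = 0#
  sum {suc n} f = f zero + sum (λ i → f (suc i))

-- Symmetric rank 3 standard integral table algebras with basis
-- A₀ = 1, A₁, A₂, given by their structure constants
-- A_i A_j = Σ_h λ i j h A_h, together with their character table
--   [ 1 k ℓ ; 1 r (-1-r) ; 1 s (-1-s) ],  r ≥ s (rows distinct).

module _ (ℝ : RealField) where
  open RealField ℝ

  IsCharacter : (Fin 3 → Fin 3 → Fin 3 → Carrier) → (Fin 3 → Carrier) → Set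
  IsCharacter λc v = v zero ≡ 1# ×
    (∀ i j → v i * v j ≡ sum (λ h → λc i j h * v h))

  δᶠ : Fin 3 → Fin 3 → Carrier
  δᶠ i j = if ⌊ i ≟ᶠ j ⌋ then 1# else 0#

  record Rank3TA : Set where
    field
      λc : Fin 3 → Fin 3 → Fin 3 → Carrier
      unitˡ : ∀ j h → λc zero j h ≡ δᶠ j h
      unitʳ : ∀ i h → λc i zero h ≡ δᶠ i h
      comm  : ∀ i j h → λc i j h ≡ λc j i h
      assoc : ∀ i j m t →
        sum (λ h → λc i j h * λc h m t) ≡ sum (λ h → λc j m h * λc i h t)
      nonneg : ∀ i j h → 0# ≤ λc i j h
      -- symmetric: λ_{ij0} = 0 for i ≠ j
      offdiag : ∀ i j → i ≢ j → λc i j zero ≡ 0#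
      -- standard integral: λ_{ii0} = δ(A_i) is a positive integer
      integral : ∀ i → ∃ λ n → 1 ℕ.≤ n × λc i i zero ≡ fromℕ n
      valency : IsCharacter λc (λ i → λc i i zero)
      r s : Carrier
      charR : IsCharacter λc (lookup (1# ∷ r ∷ (- 1# + - r) ∷ []))
      charS : IsCharacter λc (lookup (1# ∷ s ∷ (- 1# + - s) ∷ []))
      s≤r : s ≤ r
      r≢s : r ≢ s

    k ℓ : Carrier
    k = λc (suc zero) (suc zero) zero
    ℓ = λc (suc (suc zero)) (suc (suc zero)) zero

  -- The tensor square: C_{3j+i+1} = A_i ⊗ A_j, indexed 0..8 by Fin 9.

  cidx : Fin 9 → Fin 3 × Fin 3
  cidx zero = zero , zero
  cidx (suc zero) = suc zero , zero
  cidx (suc (suc zero)) = suc (suc zero) , zero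
  cidx (suc (suc (suc zero))) = zero , suc zero
  cidx (suc (suc (suc (suc zero)))) = suc zero , suc zero
  cidx (suc (suc (suc (suc (suc zero))))) = suc (suc zero) , suc zero
  cidx (suc (suc (suc (suc (suc (suc zero)))))) = zero , suc (suc zero)
  cidx (suc (suc (suc (suc (suc (suc (suc zero))))))) = suc zero , suc (suc zero)
  cidx (suc (suc (suc (suc (suc (suc (suc (suc zero)))))))) = suc (suc zero) , suc (suc zero)

  μ : Rank3TA → Fin 9 → Fin 9 → Fin 9 → Carrier
  μ A t u c = λc (proj₁ (cidx t)) (proj₁ (cidx u)) (proj₁ (cidx c))
            * λc (proj₂ (cidx t)) (proj₂ (cidx u)) (proj₂ (cidx c))
    where open Rank3TA A

-- Partitions of {2,…,9}: a labelling τ : Fin 8 → ℕ, where index x : Fin 8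
-- stands for C_{x+2}; the blocks are the fibres of τ.

Partition : Set
Partition = Fin 8 → ℕ

⟪_⟫ : Vec ℕ 8 → Partition
⟪ v ⟫ = lookup v

_≈ₚ_ : Partition → Partition → Set
τ ≈ₚ σ = ∀ x y → (τ x ≡ τ y → σ x ≡ σ y) × (σ x ≡ σ y → τ x ≡ τ y)

CoarserThan : Partition → Partition → Set
CoarserThan τ σ = ∀ x y → σ x ≡ σ y → τ x ≡ τ y

_∈ₚ_ : Partition → List Partition → Set
τ ∈ₚ L = Any (τ ≈ₚ_) L

-- the partition of {1,…,9} obtained by adding the singleton block {1}
sameBlock : Partition → Fin 9 → Fin 9 → Bool
sameBlock τ zero    zero    = true
sameBlock τ zero    (suc y) = false
sameBlock τ (suc x) zero    = false
sameBlock τ (suc x) (suc y) = ⌊ τ x ℕ.≟ τ y ⌋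

module _ (ℝ : RealField) where
  open RealField ℝ

  blockProdCoeff : Rank3TA ℝ → Partition → Fin 9 → Fin 9 → Fin 9 → Carrier
  blockProdCoeff A τ a b c =
    sum (λ t → sum (λ u →
      if sameBlock τ t a then (if sameBlock τ u b then μ ℝ A t u c else 0#)
      else 0#))

  -- τ gives a fusion of A ⊗ A: the span of C₁ and the block sums is closed
  -- under multiplication, i.e. every product of block sums has constant
  -- coefficients on each block.
  GivesFusion : Rank3TA ℝ → Partition → Set
  GivesFusion A τ = ∀ a b c c' → sameBlock τ c c' ≡ true →
    blockProdCoeff A τ a b c ≡ blockProdCoeff A τ a b c'

p2|3|456|789 p2|3|456789 p23|456|789 p23|456789 p23456789 : Partition
p2|3|456|789 = ⟪ 0 ∷ 1 ∷ 2 ∷ 2 ∷ 2 ∷ 3 ∷ 3 ∷ 3 ∷ [] ⟫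
p2|3|456789  = ⟪ 0 ∷ 1 ∷ 2 ∷ 2 ∷ 2 ∷ 2 ∷ 2 ∷ 2 ∷ [] ⟫
p23|456|789  = ⟪ 0 ∷ 0 ∷ 2 ∷ 2 ∷ 2 ∷ 3 ∷ 3 ∷ 3 ∷ [] ⟫
p23|456789   = ⟪ 0 ∷ 0 ∷ 2 ∷ 2 ∷ 2 ∷ 2 ∷ 2 ∷ 2 ∷ [] ⟫
p23456789    = ⟪ 0 ∷ 0 ∷ 0 ∷ 0 ∷ 0 ∷ 0 ∷ 0 ∷ 0 ∷ [] ⟫

p2|3456789 p23456|789 p2|3456|789 : Partition
p2|3456789  = ⟪ 0 ∷ 1 ∷ 1 ∷ 1 ∷ 1 ∷ 1 ∷ 1 ∷ 1 ∷ [] ⟫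
p23456|789  = ⟪ 0 ∷ 0 ∷ 0 ∷ 0 ∷ 0 ∷ 3 ∷ 3 ∷ 3 ∷ [] ⟫
p2|3456|789 = ⟪ 0 ∷ 1 ∷ 1 ∷ 1 ∷ 1 ∷ 3 ∷ 3 ∷ 3 ∷ [] ⟫

p2456789|3 p23789|456 p2789|3|456 : Partition
p2456789|3  = ⟪ 0 ∷ 1 ∷ 0 ∷ 0 ∷ 0 ∷ 0 ∷ 0 ∷ 0 ∷ [] ⟫
p23789|456  = ⟪ 0 ∷ 0 ∷ 2 ∷ 2 ∷ 2 ∷ 0 ∷ 0 ∷ 0 ∷ [] ⟫
p2789|3|456 = ⟪ 0 ∷ 1 ∷ 2 ∷ 2 ∷ 2 ∷ 0 ∷ 0 ∷ 0 ∷ [] ⟫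

p258|369|4|7 p258|369|47 p235689|4|7 p235689|47 : Partition
p258|369|4|7 = ⟪ 0 ∷ 1 ∷ 2 ∷ 0 ∷ 1 ∷ 3 ∷ 0 ∷ 1 ∷ [] ⟫
p258|369|47  = ⟪ 0 ∷ 1 ∷ 2 ∷ 0 ∷ 1 ∷ 2 ∷ 0 ∷ 1 ∷ [] ⟫
p235689|4|7  = ⟪ 0 ∷ 0 ∷ 2 ∷ 0 ∷ 0 ∷ 3 ∷ 0 ∷ 0 ∷ [] ⟫
p235689|47   = ⟪ 0 ∷ 0 ∷ 2 ∷ 0 ∷ 0 ∷ 2 ∷ 0 ∷ 0 ∷ [] ⟫

p2356789|4 p24578|369 p2578|369|4 : Partition
p2356789|4  = ⟪ 0 ∷ 0 ∷ 2 ∷ 0 ∷ 0 ∷ 0 ∷ 0 ∷ 0 ∷ [] ⟫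
p24578|369  = ⟪ 0 ∷ 1 ∷ 0 ∷ 0 ∷ 1 ∷ 0 ∷ 0 ∷ 1 ∷ [] ⟫
p2578|369|4 = ⟪ 0 ∷ 1 ∷ 2 ∷ 0 ∷ 1 ∷ 0 ∷ 0 ∷ 1 ∷ [] ⟫

p2345689|7 p258|34679 p258|3469|7 : Partition
p2345689|7  = ⟪ 0 ∷ 0 ∷ 0 ∷ 0 ∷ 0 ∷ 3 ∷ 0 ∷ 0 ∷ [] ⟫
p258|34679  = ⟪ 0 ∷ 1 ∷ 1 ∷ 0 ∷ 1 ∷ 1 ∷ 0 ∷ 1 ∷ [] ⟫
p258|3469|7 = ⟪ 0 ∷ 1 ∷ 1 ∷ 0 ∷ 1 ∷ 3 ∷ 0 ∷ 1 ∷ [] ⟫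

listAll₁ listK₁ listL₁ listAll₂ listK₂ listL₂ : List Partition
listAll₁ = p2|3|456|789 ∷ p2|3|456789 ∷ p23|456|789 ∷ p23|456789 ∷ p23456789 ∷ []
listK₁   = p2|3456789 ∷ p23456|789 ∷ p2|3456|789 ∷ []
listL₁   = p2456789|3 ∷ p23789|456 ∷ p2789|3|456 ∷ []
listAll₂ = p258|369|4|7 ∷ p258|369|47 ∷ p235689|4|7 ∷ p235689|47 ∷ p23456789 ∷ []
listK₂   = p2356789|4 ∷ p24578|369 ∷ p2578|369|4 ∷ []
listL₂   = p2345689|7 ∷ p258|34679 ∷ p258|3469|7 ∷ []

module _ (ℝ : RealField) where
  open RealField ℝ

  Classification : Partition → List Partition → List Partition →
                   List Partition → Set
  Classification base Lall LK LL =
    ∀ (τ : Partition) → CoarserThan τ base →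
      (((∀ (A : Rank3TA ℝ) → GivesFusion ℝ A τ) → τ ∈ₚ Lall) ×
       (τ ∈ₚ Lall → ∀ (A : Rank3TA ℝ) → GivesFusion ℝ A τ)) ×
      (¬' (τ ∈ₚ Lall) → ∀ (A : Rank3TA ℝ) →
        let open Rank3TA A in
        (GivesFusion ℝ A τ →
           (k ≡ r × s ≡ - 1# × τ ∈ₚ LK) ⊎ (ℓ ≡ - 1# + - s × r ≡ 0# × τ ∈ₚ LL)) ×
        ((k ≡ r × s ≡ - 1# × τ ∈ₚ LK) ⊎ (ℓ ≡ - 1# + - s × r ≡ 0# × τ ∈ₚ LL) →
           GivesFusion ℝ A τ))
    where
      open import Data.Empty using (⊥)
      ¬' : Set → Set
      ¬' P = P → ⊥

-- Solving the equations of the two nontrivial characters, which differ at A₁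
-- since r ≠ s, expresses every structure constant of 𝒜 as a polynomial in
-- k, ℓ, r, s; hence so is every coefficient of a product of block sums in
-- 𝒜 ⊗ 𝒜, and these are computed symbolically. A partition gives a fusion for
-- all 𝒜 when the coefficients are constant on blocks identically, and under
-- k = r, s = -1 or ℓ = -1 - s, r = 0 when they are so after that substitution.
-- For every other partition some coefficient difference is a polynomial which,
-- modulo the valency relation k(1 + r)(1 + s) + (k + rs)ℓ = 0 and using
-- k, ℓ ≥ 1, r ≥ s and λ₁₂¹, λ₁₂² ≥ 0, forces one of these conditions or
-- cannot vanish at all; the Petersen graph satisfies neither condition. Up to
-- relabelling only 15 partitions are coarser than 2|3|456|789, and part (2)
-- is part (1) with the two tensor factors exchanged.

module Submission where

open import Defs
open import Level using (0ℓ)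
open import Algebra.Bundles using (CommutativeRing; RawRing)
open import Algebra.Solver.Ring.AlmostCommutativeRing using (fromCommutativeRing; _-Raw-AlmostCommutative⟶_)
import Algebra.Solver.Ring
import Algebra.Solver.Ring.NaturalCoefficients.Default
open import Data.Nat as ℕ using (ℕ; suc; s≤s; z≤n)
open import Data.Nat.Properties using (≡ᵇ⇒≡; ≡⇒≡ᵇ)
open import Data.Fin using (Fin; zero; suc; toℕ; lift)
open import Data.Fin.Patterns using (0F; 1F; 2F; 3F; 4F; 5F; 6F; 7F)
open import Data.Fin.Properties using (all?; toℕ-injective) renaming (_≟_ to _≟ᶠ_)
open import Data.Fin.Permutation using (permutation)
open import Data.Bool using (Bool; true; false; if_then_else_; T; T?)
open import Data.Bool.Properties using (T-≡)
open import Data.Maybe using (Maybe; just; nothing; is-just; to-witness-T)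
open import Data.Product as Product using (_×_; _,_; proj₁; proj₂)
open import Data.Product.Properties using (≡-dec)
open import Data.Sum as Sum using (_⊎_; inj₁; inj₂; [_,_])
open import Data.Empty using (⊥)
open import Data.List using (List; []; _∷_)
open import Data.List.Relation.Unary.Any as Any using (Any; any?)
open import Data.List.Relation.Unary.All as All using (All; []; _∷_; lookupAny)
open import Data.Vec using (Vec; []; _∷_; lookup; tabulate)
import Data.Vec as Vec
import Data.Vec.Properties as Vec
open import Function using (_∘_; id; _⇔_; mk⇔; Equivalence)
open import Relation.Nullary using (Dec; yes; no; ¬_; ¬?; contradiction)
open import Relation.Nullary.Decidable
  using (⌊_⌋; _×-dec_; _→-dec_; True; False; toWitness; toWitnessFalse; from-yes)
open import Relation.Binary.Structures using (IsTotalOrder)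
open import Relation.Binary.PropositionalEquality as ≡ using (_≡_; _≢_; _≗_)

module IntegerRingSolver {c ℓ} (R : CommutativeRing c ℓ) where
  open CommutativeRing R
  open import Algebra.Properties.Ring ring
    using (//-rightDividesˡ; //-rightDividesʳ; ⁻¹-anti-homo‿-; -0#≈0#)
  open import Algebra.Properties.Semiring.Mult semiring using (×-homo-+; ×1-homo-*) renaming (_×_ to _·_)
  open import Algebra.Properties.Semiring.Exp semiring using (^-congˡ)
  open import Relation.Binary.Reasoning.Setoid setoid
  private module NS = Algebra.Solver.Ring.NaturalCoefficients.Default commutativeSemiring

  -- A pair (a , b) is the integer a − b; the solver only needs to decide
  -- equality of coefficients, which for pairs is the ℕ-equation a + d ≡ c + b.
  ℤ-as-differences : RawRing 0ℓ 0ℓ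
  ℤ-as-differences = record
    { Carrier = ℕ × ℕ ; _≈_ = _≡_
    ; _+_ = λ { (a , b) (c , d) → a ℕ.+ c , b ℕ.+ d }
    ; _*_ = λ { (a , b) (c , d) → a ℕ.* c ℕ.+ b ℕ.* d , a ℕ.* d ℕ.+ b ℕ.* c }
    ; -_ = λ { (a , b) → b , a }
    ; 0# = 0 , 0 ; 1# = 1 , 0 }

  ⌜_⌝ : ℕ → Carrier
  ⌜ 0 ⌝           = 0#
  ⌜ 1 ⌝           = 1#
  ⌜ suc (suc n) ⌝ = 1# + ⌜ suc n ⌝

  -- Small constants denote 0#, 1#, - 1# on the nose, so that evaluated
  -- polynomials match hand-written ring expressions definitionally.
  ι : ℕ × ℕ → Carrier
  ι (a     , 0)     = ⌜ a ⌝
  ι (0     , suc b) = - ⌜ suc b ⌝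
  ι (suc a , suc b) = ⌜ suc a ⌝ - ⌜ suc b ⌝

  ⌜⌝≈·1# : ∀ n → ⌜ n ⌝ ≈ n · 1#
  ⌜⌝≈·1# 0             = refl
  ⌜⌝≈·1# 1             = sym (+-identityʳ 1#)
  ⌜⌝≈·1# (suc (suc n)) = +-congˡ (⌜⌝≈·1# (suc n))

  private
    difference : ℕ × ℕ → Carrier
    difference (a , b) = a · 1# - b · 1#

    −-cong : ∀ {x x′ y y′} → x ≈ x′ → y ≈ y′ → x - y ≈ x′ - y′
    −-cong x≈x′ y≈y′ = +-cong x≈x′ (-‿cong y≈y′)

    −-unique : ∀ {x y z} → x ≈ z + y → x - y ≈ z
    −-unique {x} {y} {z} x≈z+y = trans (+-congʳ x≈z+y) (//-rightDividesʳ y z)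

    −+-cancel : ∀ x y → (x - y) + y ≈ x
    −+-cancel x y = //-rightDividesˡ y x

    ·1#-homo-+ : ∀ m n {x y} → m · 1# ≈ x → n · 1# ≈ y → (m ℕ.+ n) · 1# ≈ x + y
    ·1#-homo-+ m n m≈x n≈y = trans (×-homo-+ 1# m n) (+-cong m≈x n≈y)

    -- Each identity is reduced, by writing x as (x - y) + y, to one without
    -- subtraction, which the natural-coefficient solver proves.
    difference-+-homo : ∀ p q → difference (RawRing._+_ ℤ-as-differences p q) ≈ difference p + difference q
    difference-+-homo (a , b) (c , d) = −-unique (begin
      (a ℕ.+ c) · 1#                 ≈⟨ ·1#-homo-+ a c (sym (−+-cancel A B)) (sym (−+-cancel C D)) ⟩
      ((A - B) + B) + ((C - D) + D)  ≈⟨ NS.solve 4 (λ u b v d → (u :+ b) :+ (v :+ d) := (u :+ v) :+ (b :+ d))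
                                                   refl (A - B) B (C - D) D ⟩
      ((A - B) + (C - D)) + (B + D)  ≈⟨ +-congˡ (×-homo-+ 1# b d) ⟨
      ((A - B) + (C - D)) + (b ℕ.+ d) · 1# ∎)
      where
      open NS
      A B C D : Carrier
      A = a · 1# ; B = b · 1# ; C = c · 1# ; D = d · 1#

    difference-*-homo : ∀ p q → difference (RawRing._*_ ℤ-as-differences p q) ≈ difference p * difference q
    difference-*-homo (a , b) (c , d) = −-unique (begin
      (a ℕ.* c ℕ.+ b ℕ.* d) · 1#
        ≈⟨ ·1#-homo-+ (a ℕ.* c) (b ℕ.* d) (×1-homo-* a c) (×1-homo-* b d) ⟩
      A * C + B * D
        ≈⟨ +-congʳ (*-cong (−+-cancel A B) (−+-cancel C D)) ⟨
      ((A - B) + B) * ((C - D) + D) + B * D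
        ≈⟨ NS.solve 4 (λ u b v d → (u :+ b) :* (v :+ d) :+ b :* d := u :* v :+ ((u :+ b) :* d :+ b :* (v :+ d)))
                      refl (A - B) B (C - D) D ⟩
      (A - B) * (C - D) + (((A - B) + B) * D + B * ((C - D) + D))
        ≈⟨ +-congˡ (+-cong (*-congʳ (−+-cancel A B)) (*-congˡ (−+-cancel C D))) ⟩
      (A - B) * (C - D) + (A * D + B * C)
        ≈⟨ +-congˡ (·1#-homo-+ (a ℕ.* d) (b ℕ.* c) (×1-homo-* a d) (×1-homo-* b c)) ⟨
      (A - B) * (C - D) + (a ℕ.* d ℕ.+ b ℕ.* c) · 1# ∎)
      where
      open NS
      A B C D : Carrier
      A = a · 1# ; B = b · 1# ; C = c · 1# ; D = d · 1#

    difference-‿homo : ∀ p → difference (RawRing.-_ ℤ-as-differences p) ≈ - difference p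
    difference-‿homo (a , b) = sym (⁻¹-anti-homo‿- (a · 1#) (b · 1#))

    difference-cong : ∀ a b c d → a ℕ.+ d ≡ c ℕ.+ b → difference (a , b) ≈ difference (c , d)
    difference-cong a b c d a+d≡c+b = −-unique (begin
      A            ≈⟨ //-rightDividesʳ D A ⟨
      (A + D) - D  ≈⟨ +-congʳ (trans (sym (×-homo-+ 1# a d))
                                (trans (reflexive (≡.cong (_· 1#) a+d≡c+b)) (×-homo-+ 1# c b))) ⟩
      (C + B) - D  ≈⟨ NS.solve 3 (λ c b w → (c :+ b) :+ w := (c :+ w) :+ b) refl C B (- D) ⟩
      (C - D) + B  ∎)
      where
      open NS
      A B C D : Carrier
      A = a · 1# ; B = b · 1# ; C = c · 1# ; D = d · 1#

    ι≈difference : ∀ p → ι p ≈ difference p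
    ι≈difference (a     , 0)     = trans (⌜⌝≈·1# a) (sym (trans (+-congˡ -0#≈0#) (+-identityʳ _)))
    ι≈difference (0     , suc b) = trans (-‿cong (⌜⌝≈·1# (suc b))) (sym (+-identityˡ _))
    ι≈difference (suc a , suc b) = −-cong (⌜⌝≈·1# (suc a)) (⌜⌝≈·1# (suc b))

  ι-homomorphism : ℤ-as-differences -Raw-AlmostCommutative⟶ fromCommutativeRing R
  ι-homomorphism = record
    { ⟦_⟧    = ι
    ; +-homo = λ p q → trans (ι≈difference (RawRing._+_ ℤ-as-differences p q))
                             (trans (difference-+-homo p q) (sym (+-cong (ι≈difference p) (ι≈difference q))))
    ; *-homo = λ p q → trans (ι≈difference (RawRing._*_ ℤ-as-differences p q))
                             (trans (difference-*-homo p q) (sym (*-cong (ι≈difference p) (ι≈difference q))))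
    ; -‿homo = λ p → trans (ι≈difference (RawRing.-_ ℤ-as-differences p))
                           (trans (difference-‿homo p) (-‿cong (sym (ι≈difference p))))
    ; 0-homo = refl
    ; 1-homo = refl
    }

  coefficient? : ∀ p q → Maybe (ι p ≈ ι q)
  coefficient? (a , b) (c , d) with a ℕ.+ d ℕ.≟ c ℕ.+ b
  ... | yes a+d≡c+b = just (trans (ι≈difference (a , b))
                               (trans (difference-cong a b c d a+d≡c+b) (sym (ι≈difference (c , d)))))
  ... | no _        = nothing

  open Algebra.Solver.Ring ℤ-as-differences (fromCommutativeRing R) ι-homomorphism coefficient? public
    using (Polynomial; op; con; var; _:^_; :-_; _:+_; _:*_; _:-_; ⟦_⟧)
  open Algebra.Solver.Ring ℤ-as-differences (fromCommutativeRing R) ι-homomorphism coefficient?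
    using ([+]; [*]; normalise; correct; _≟N_; ⟦_⟧N-cong)

  identity? : ∀ {n} (p q : Polynomial n) → Maybe (∀ ρ → ⟦ p ⟧ ρ ≈ ⟦ q ⟧ ρ)
  identity? p q with normalise p ≟N normalise q
  ... | just p≈q = just (λ ρ → trans (sym (correct p ρ)) (trans (⟦ p≈q ⟧N-cong ρ) (correct q ρ)))
  ... | nothing  = nothing

  IsIdentity : ∀ {n} → Polynomial n → Polynomial n → Set
  IsIdentity p q = T (is-just (identity? p q))

  identity : ∀ {n} (p q : Polynomial n) → {IsIdentity p q} → ∀ ρ → ⟦ p ⟧ ρ ≈ ⟦ q ⟧ ρ
  identity p q {holds} = to-witness-T (identity? p q) holds

  Vanishes : ∀ {n} → Vec Carrier n → Polynomial n → Set ℓ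
  Vanishes ρ p = ⟦ p ⟧ ρ ≈ 0#

  combination : ∀ {n} → List (Polynomial n × Polynomial n) → Polynomial n
  combination []              = con (0 , 0)
  combination ((q , e) ∷ qes) = q :* e :+ combination qes

  combination-vanishes : ∀ {n ρ} (qes : List (Polynomial n × Polynomial n)) →
                         All (Vanishes ρ ∘ proj₂) qes → Vanishes ρ (combination qes)
  combination-vanishes []              []         = refl
  combination-vanishes {ρ = ρ} ((q , e) ∷ qes) (e≈0 ∷ es) = begin
    ⟦ q ⟧ ρ * ⟦ e ⟧ ρ + ⟦ combination qes ⟧ ρ  ≈⟨ +-cong (*-congˡ e≈0) (combination-vanishes qes es) ⟩
    ⟦ q ⟧ ρ * 0# + 0#                         ≈⟨ +-identityʳ _ ⟩
    ⟦ q ⟧ ρ * 0#                              ≈⟨ zeroʳ _ ⟩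
    0#                                        ∎

  vanishes-by : ∀ {n} (p : Polynomial n) qes → {IsIdentity p (combination qes)} →
                ∀ ρ → All (Vanishes ρ ∘ proj₂) qes → Vanishes ρ p
  vanishes-by p qes {p≈Σ} ρ es =
    trans (identity p (combination qes) {p≈Σ} ρ) (combination-vanishes qes es)

  substitute : ∀ {m n} → Vec (Polynomial n) m → Polynomial m → Polynomial n
  substitute σ (op o p q) = op o (substitute σ p) (substitute σ q)
  substitute σ (con c)    = con c
  substitute σ (var x)    = lookup σ x
  substitute σ (p :^ k)   = substitute σ p :^ k
  substitute σ (:- p)     = :- substitute σ p

  ⟦substitute⟧ : ∀ {m n} (σ : Vec (Polynomial n) m) p ρ →
                 ⟦ substitute σ p ⟧ ρ ≈ ⟦ p ⟧ (Vec.map (λ q → ⟦ q ⟧ ρ) σ)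
  ⟦substitute⟧ σ (op [+] p q) ρ = +-cong (⟦substitute⟧ σ p ρ) (⟦substitute⟧ σ q ρ)
  ⟦substitute⟧ σ (op [*] p q) ρ = *-cong (⟦substitute⟧ σ p ρ) (⟦substitute⟧ σ q ρ)
  ⟦substitute⟧ σ (con c)      ρ = refl
  ⟦substitute⟧ σ (var x)      ρ = reflexive (≡.sym (Vec.lookup-map x (λ q → ⟦ q ⟧ ρ) σ))
  ⟦substitute⟧ σ (p :^ k)     ρ = ^-congˡ k (⟦substitute⟧ σ p ρ)
  ⟦substitute⟧ σ (:- p)       ρ = -‿cong (⟦substitute⟧ σ p ρ)

open ≡ using (refl; sym; trans; cong; cong₂; subst; subst₂; module ≡-Reasoning)

first : ∀ {n} → (Fin (suc n) → Bool) → Fin (suc n)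
first {ℕ.zero} p = zero
first {suc n}  p = if p zero then zero else suc (first (p ∘ suc))

first-holds : ∀ {n} (p : Fin (suc n) → Bool) {i} → p i ≡ true → p (first p) ≡ true
first-holds {ℕ.zero} p {zero} pi = pi
first-holds {suc n} p {i} pi with p zero in p0
... | true = p0
first-holds {suc n} p {zero}  pi | false = contradiction (trans (sym pi) p0) λ ()
first-holds {suc n} p {suc i} pi | false = first-holds (p ∘ suc) pi

first-cong : ∀ {n} {p q : Fin (suc n) → Bool} → p ≗ q → first p ≡ first q
first-cong {ℕ.zero} p≗q = refl
first-cong {suc n} {p} {q} p≗q rewrite p≗q zero with q zero
... | true  = refl
... | false = cong suc (first-cong (p≗q ∘ suc))

sameBlock-refl : ∀ τ c → sameBlock τ c c ≡ true
sameBlock-refl τ zero = refl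
sameBlock-refl τ (suc x) with τ x ℕ.≟ τ x
... | yes _   = refl
... | no τx≢τx = contradiction refl τx≢τx

sameBlock-≡ : ∀ τ a a′ → sameBlock τ a a′ ≡ true → ∀ t → sameBlock τ t a ≡ sameBlock τ t a′
sameBlock-≡ τ zero    zero    _ t = refl
sameBlock-≡ τ (suc x) (suc y) h zero = refl
sameBlock-≡ τ (suc x) (suc y) h (suc z) with τ x ℕ.≟ τ y
... | yes τx≡τy = cong (λ v → ⌊ τ z ℕ.≟ v ⌋) τx≡τy

sameBlock-sym : ∀ τ a a′ → sameBlock τ a a′ ≡ true → sameBlock τ a′ a ≡ true
sameBlock-sym τ a a′ h = trans (sameBlock-≡ τ a a′ h a′) (sameBlock-refl τ a′)

sameBlock-resp-≈ₚ : ∀ {τ σ} → τ ≈ₚ σ → ∀ a b → sameBlock τ a b ≡ sameBlock σ a b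
sameBlock-resp-≈ₚ τ≈σ zero    zero    = refl
sameBlock-resp-≈ₚ τ≈σ zero    (suc b) = refl
sameBlock-resp-≈ₚ τ≈σ (suc a) zero    = refl
sameBlock-resp-≈ₚ {τ} {σ} τ≈σ (suc a) (suc b) with τ a ℕ.≟ τ b | σ a ℕ.≟ σ b
... | yes _ | yes _ = refl
... | no  _ | no  _ = refl
... | yes τa≡τb | no σa≢σb = contradiction (proj₁ (τ≈σ a b) τa≡τb) σa≢σb
... | no τa≢τb | yes σa≡σb = contradiction (proj₂ (τ≈σ a b) σa≡σb) τa≢τb

sameBlock-∘ : ∀ τ (π : Fin 8 → Fin 8) t c → sameBlock (τ ∘ π) t c ≡ sameBlock τ (lift 1 π t) (lift 1 π c)
sameBlock-∘ τ π zero    zero    = refl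
sameBlock-∘ τ π zero    (suc c) = refl
sameBlock-∘ τ π (suc t) zero    = refl
sameBlock-∘ τ π (suc t) (suc c) = refl

rep : Partition → Fin 9 → Fin 9
rep τ c = first (λ t → sameBlock τ t c)

rep-sameBlock : ∀ τ c → sameBlock τ (rep τ c) c ≡ true
rep-sameBlock τ c = first-holds (λ t → sameBlock τ t c) {c} (sameBlock-refl τ c)

rep-cong : ∀ τ c c′ → sameBlock τ c c′ ≡ true → rep τ c ≡ rep τ c′
rep-cong τ c c′ h = first-cong (sameBlock-≡ τ c c′ h)

rep-idem : ∀ τ c → rep τ (rep τ c) ≡ rep τ c
rep-idem τ c = rep-cong τ (rep τ c) c (rep-sameBlock τ c)

≈ₚ-sym : ∀ {τ σ} → τ ≈ₚ σ → σ ≈ₚ τ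
≈ₚ-sym τ≈σ x y = proj₂ (τ≈σ x y) , proj₁ (τ≈σ x y)

≈ₚ-trans : ∀ {τ σ υ} → τ ≈ₚ σ → σ ≈ₚ υ → τ ≈ₚ υ
≈ₚ-trans τ≈σ σ≈υ x y = proj₁ (σ≈υ x y) ∘ proj₁ (τ≈σ x y) , proj₂ (τ≈σ x y) ∘ proj₂ (σ≈υ x y)

≗⇒≈ₚ : ∀ {τ σ} → τ ≗ σ → τ ≈ₚ σ
≗⇒≈ₚ τ≗σ x y = (λ τx≡τy → trans (sym (τ≗σ x)) (trans τx≡τy (τ≗σ y))) ,
                (λ σx≡σy → trans (τ≗σ x) (trans σx≡σy (sym (τ≗σ y))))

∘-≈ₚ : ∀ {τ σ} (π : Fin 8 → Fin 8) → τ ≈ₚ σ → (τ ∘ π) ≈ₚ (σ ∘ π)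
∘-≈ₚ π τ≈σ x y = τ≈σ (π x) (π y)

_≈ₚ?_ : ∀ τ σ → Dec (τ ≈ₚ σ)
τ ≈ₚ? σ = all? λ x → all? λ y →
  ((τ x ℕ.≟ τ y) →-dec (σ x ℕ.≟ σ y)) ×-dec ((σ x ℕ.≟ σ y) →-dec (τ x ℕ.≟ τ y))

_∈ₚ?_ : ∀ τ L → Dec (τ ∈ₚ L)
τ ∈ₚ? L = any? (τ ≈ₚ?_) L

∈ₚ-resp-≈ₚ : ∀ {τ σ} L → τ ≈ₚ σ → τ ∈ₚ L → σ ∈ₚ L
∈ₚ-resp-≈ₚ L τ≈σ = Any.map (≈ₚ-trans (≈ₚ-sym τ≈σ))

CoarserThan-resp-≈ₚ : ∀ {τ σ σ′} → σ′ ≈ₚ σ → CoarserThan τ σ → CoarserThan τ σ′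
CoarserThan-resp-≈ₚ σ′≈σ τ≥σ x y = τ≥σ x y ∘ proj₁ (σ′≈σ x y)

label : ∀ {n} → (Fin (suc n) → ℕ) → Fin (suc n) → Fin (suc n)
label f i = first (λ j → f j ℕ.≡ᵇ f i)

label-holds : ∀ {n} (f : Fin (suc n) → ℕ) i → f (label f i) ≡ f i
label-holds f i = ≡ᵇ⇒≡ _ _ (Equivalence.from T-≡ (first-holds (λ j → f j ℕ.≡ᵇ f i) {i}
                                                  (Equivalence.to T-≡ (≡⇒≡ᵇ (f i) (f i) refl))))

label-≡⇔ : ∀ {n} (f : Fin (suc n) → ℕ) i j → label f i ≡ label f j ⇔ f i ≡ f j
label-≡⇔ f i j = mk⇔
  (λ li≡lj → trans (sym (label-holds f i)) (trans (cong f li≡lj) (label-holds f j)))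
  (λ fi≡fj → first-cong (λ k → cong (f k ℕ.≡ᵇ_) fi≡fj))

≈ₚ-label : ∀ {n} (f : Fin (suc n) → ℕ) (blk : Fin 8 → Fin (suc n)) → (f ∘ blk) ≈ₚ (toℕ ∘ label f ∘ blk)
≈ₚ-label f blk x y =
  (λ fx≡fy → cong toℕ (Equivalence.from (label-≡⇔ f (blk x) (blk y)) fx≡fy)) ,
  (λ lx≡ly → Equivalence.to (label-≡⇔ f (blk x) (blk y)) (toℕ-injective lx≡ly))

-- A partition coarser than σ only depends on which block of σ an element
-- lies in, so up to relabelling it is a function of the block index.
coarsening-cover : ∀ {m} (σ : Partition) (rp : Fin (suc m) → Fin 8) (blk : Fin 8 → Fin (suc m)) →
                   (∀ x → σ x ≡ σ (rp (blk x))) → (L : List Partition) →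
                   (∀ (v : Vec (Fin (suc m)) (suc m)) → (toℕ ∘ lookup v ∘ blk) ∈ₚ L) →
                   ∀ τ → CoarserThan τ σ → τ ∈ₚ L
coarsening-cover σ rp blk σ-factors L covered τ τ≥σ =
  ∈ₚ-resp-≈ₚ L (≈ₚ-sym τ≈) (covered (tabulate (label (τ ∘ rp))))
  where
  τ-factors : ∀ x → τ x ≡ τ (rp (blk x))
  τ-factors x = τ≥σ x (rp (blk x)) (σ-factors x)
  τ≈ : τ ≈ₚ (toℕ ∘ lookup (tabulate (label (τ ∘ rp))) ∘ blk)
  τ≈ = ≈ₚ-trans (≗⇒≈ₚ τ-factors) (≈ₚ-trans (≈ₚ-label (τ ∘ rp) blk)
         (≗⇒≈ₚ λ x → cong toℕ (sym (Vec.lookup∘tabulate (label (τ ∘ rp)) (blk x)))))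

-- exchanging the two tensor factors, A_i ⊗ A_j ↦ A_j ⊗ A_i, on C₂, …, C₉
swap : Fin 8 → Fin 8
swap = lookup (2F ∷ 5F ∷ 0F ∷ 3F ∷ 6F ∷ 1F ∷ 4F ∷ 7F ∷ [])

swap-involutive : ∀ x → swap (swap x) ≡ x
swap-involutive = from-yes (all? λ x → swap (swap x) ≟ᶠ x)

swap⁺ : Fin 9 → Fin 9
swap⁺ = lift 1 swap

swap⁺-involutive : ∀ t → swap⁺ (swap⁺ t) ≡ t
swap⁺-involutive zero    = refl
swap⁺-involutive (suc x) = cong suc (swap-involutive x)

∘swap-≈ₚ⇔ : ∀ τ σ → (τ ∘ swap) ≈ₚ (σ ∘ swap) ⇔ τ ≈ₚ σ
∘swap-≈ₚ⇔ τ σ = mk⇔ (λ τswap≈σswap → ≈ₚ-trans (≗⇒≈ₚ (cong τ ∘ sym ∘ swap-involutive))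
                                          (≈ₚ-trans (∘-≈ₚ swap τswap≈σswap) (≗⇒≈ₚ (cong σ ∘ swap-involutive))))
                        (∘-≈ₚ swap)

≈ₚ-swap-transpose : ∀ {τ σ} → (τ ∘ swap) ≈ₚ σ → τ ≈ₚ (σ ∘ swap)
≈ₚ-swap-transpose {τ} {σ} τswap≈σ =
  Equivalence.to (∘swap-≈ₚ⇔ τ (σ ∘ swap)) (≈ₚ-trans τswap≈σ (≗⇒≈ₚ (cong σ ∘ sym ∘ swap-involutive)))

SwapImage : List Partition → List Partition → Set
SwapImage L₁ L₂ = All (λ σ → (σ ∘ swap) ∈ₚ L₂) L₁ × All (λ σ → (σ ∘ swap) ∈ₚ L₁) L₂

swapImage? : ∀ L₁ L₂ → Dec (SwapImage L₁ L₂)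
swapImage? L₁ L₂ = All.all? (λ σ → (σ ∘ swap) ∈ₚ? L₂) L₁
             ×-dec All.all? (λ σ → (σ ∘ swap) ∈ₚ? L₁) L₂

∈ₚ-swapImage : ∀ {L₁ L₂} → SwapImage L₁ L₂ → ∀ τ → (τ ∘ swap) ∈ₚ L₁ ⇔ τ ∈ₚ L₂
∈ₚ-swapImage {L₁} {L₂} (L₁⊆L₂ , L₂⊆L₁) τ = mk⇔
  (λ τswap∈L₁ → let σswap∈L₂ , τswap≈σ = All.lookupAny L₁⊆L₂ τswap∈L₁
                in ∈ₚ-resp-≈ₚ L₂ (≈ₚ-sym (≈ₚ-swap-transpose τswap≈σ)) σswap∈L₂)
  (λ τ∈L₂ → let σswap∈L₁ , τ≈σ = All.lookupAny L₂⊆L₁ τ∈L₂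
            in ∈ₚ-resp-≈ₚ L₁ (≈ₚ-sym (∘-≈ₚ swap τ≈σ)) σswap∈L₁)

module Fusion (ℝ : RealField) where
  open RealField ℝ

  ℝ-ring : CommutativeRing 0ℓ 0ℓ
  ℝ-ring = record { isCommutativeRing = isCommutativeRing }

  open CommutativeRing ℝ-ring using
    ( _-_; +-identityˡ; +-identityʳ; +-comm; *-comm; *-assoc; *-identityˡ; zeroʳ; -‿inverseˡ; -‿inverseʳ
    ; ring; +-commutativeMonoid )
  open import Algebra.Properties.Ring ring using
    ( x∙y⁻¹≈ε⇒x≈y; x≈y⇒x∙y⁻¹≈ε; //-rightDividesˡ; //-rightDividesʳ; +-inverseʳ-unique; +-identityʳ-unique
    ; -‿+-comm; -‿involutive; -1*x≈-x )
  open import Algebra.Properties.CommutativeMonoid.Sum +-commutativeMonoid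
    using (sum-permute) renaming (sum to Σ)
  open IntegerRingSolver ℝ-ring
  open ≡-Reasoning
  private module ≤ = IsTotalOrder isTotalOrder

  +-nonneg : ∀ {x y} → 0# ≤ x → 0# ≤ y → 0# ≤ x + y
  +-nonneg {x} {y} 0≤x 0≤y = ≤.trans 0≤x (subst₂ _≤_ (+-identityˡ x) (+-comm y x) (+-mono-≤ x 0≤y))

  ≤⇒0≤- : ∀ {x y} → x ≤ y → 0# ≤ y - x
  ≤⇒0≤- {x} x≤y = subst₂ _≤_ (-‿inverseʳ x) refl (+-mono-≤ (- x) x≤y)

  0≤1 : 0# ≤ 1#
  0≤1 with ≤.total 0# 1#
  ... | inj₁ 0≤1 = 0≤1
  ... | inj₂ 1≤0 = contradiction (≤.antisym 1≤0 (subst₂ _≤_ refl -1*-1≡1 (*-nonneg 0≤-1 0≤-1))) (0≢1 ∘ sym)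
    where
    0≤-1 : 0# ≤ - 1#
    0≤-1 = subst₂ _≤_ (-‿inverseʳ 1#) (+-identityˡ (- 1#)) (+-mono-≤ (- 1#) 1≤0)
    -1*-1≡1 : - 1# * - 1# ≡ 1#
    -1*-1≡1 = trans (-1*x≈-x (- 1#)) (-‿involutive 1#)

  0≤-⇒≤ : ∀ {x y} → 0# ≤ y - x → x ≤ y
  0≤-⇒≤ {x} {y} 0≤y-x = subst₂ _≤_ (+-identityˡ x) (//-rightDividesˡ x y) (+-mono-≤ x 0≤y-x)

  1+≢0 : ∀ {x} → 0# ≤ x → 1# + x ≢ 0#
  1+≢0 {x} 0≤x 1+x≡0 =
    0≢1 (≤.antisym 0≤1 (subst₂ _≤_ (+-identityˡ 1#) (trans (+-comm x 1#) 1+x≡0) (+-mono-≤ 1# 0≤x)))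

  fromℕ-nonneg : ∀ n → 0# ≤ fromℕ n
  fromℕ-nonneg ℕ.zero = ≤.refl
  fromℕ-nonneg (suc n) = +-nonneg 0≤1 (fromℕ-nonneg n)

  *-cancelˡ-≡0 : ∀ {x y} → x ≢ 0# → x * y ≡ 0# → y ≡ 0#
  *-cancelˡ-≡0 {x} {y} x≢0 xy≡0 = let x⁻¹ , xx⁻¹≡1 = inverse x x≢0 in begin
    y              ≡⟨ *-identityˡ y ⟨
    1# * y         ≡⟨ cong (_* y) (trans (sym xx⁻¹≡1) (*-comm x x⁻¹)) ⟩
    (x⁻¹ * x) * y  ≡⟨ *-assoc x⁻¹ x y ⟩
    x⁻¹ * (x * y)  ≡⟨ cong (x⁻¹ *_) xy≡0 ⟩
    x⁻¹ * 0#       ≡⟨ zeroʳ x⁻¹ ⟩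
    0#             ∎

  infixl 6 _⊕_
  infixl 7 _⊗_

  data Nonneg (n : ℕ) : Set where
    one     : Nonneg n
    atom    : Fin n → Nonneg n
    _⊕_ _⊗_ : Nonneg n → Nonneg n → Nonneg n

  𝟘 𝟙 : ∀ {n} → Polynomial n
  𝟘 = con (0 , 0)
  𝟙 = con (1 , 0)

  ⟦_⟧⁺ : ∀ {n m} → Nonneg n → (Fin n → Polynomial m) → Polynomial m
  ⟦ one    ⟧⁺ atoms = 𝟙
  ⟦ atom i ⟧⁺ atoms = atoms i
  ⟦ e ⊕ e′ ⟧⁺ atoms = ⟦ e ⟧⁺ atoms :+ ⟦ e′ ⟧⁺ atoms
  ⟦ e ⊗ e′ ⟧⁺ atoms = ⟦ e ⟧⁺ atoms :* ⟦ e′ ⟧⁺ atoms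

  ⟦⟧⁺-nonneg : ∀ {n m} {atoms : Fin n → Polynomial m} {ρ} → (∀ i → 0# ≤ ⟦ atoms i ⟧ ρ) →
               ∀ e → 0# ≤ ⟦ ⟦ e ⟧⁺ atoms ⟧ ρ
  ⟦⟧⁺-nonneg atoms≥0 one      = 0≤1
  ⟦⟧⁺-nonneg atoms≥0 (atom i) = atoms≥0 i
  ⟦⟧⁺-nonneg atoms≥0 (e ⊕ e′) = +-nonneg (⟦⟧⁺-nonneg atoms≥0 e) (⟦⟧⁺-nonneg atoms≥0 e′)
  ⟦⟧⁺-nonneg atoms≥0 (e ⊗ e′) = *-nonneg (⟦⟧⁺-nonneg atoms≥0 e) (⟦⟧⁺-nonneg atoms≥0 e′)

  -- 1 + e is positive at ρ, so it is no combination of polynomials vanishing at ρ.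
  refute : ∀ {n m} {atoms : Fin n → Polynomial m} {ρ} → (∀ i → 0# ≤ ⟦ atoms i ⟧ ρ) →
           ∀ e qes → {IsIdentity (𝟙 :+ ⟦ e ⟧⁺ atoms) (combination qes)} →
           All (Vanishes ρ ∘ proj₂) qes → ⊥
  refute {atoms = atoms} {ρ} atoms≥0 e qes {cert} es =
    1+≢0 (⟦⟧⁺-nonneg atoms≥0 e) (vanishes-by (𝟙 :+ ⟦ e ⟧⁺ atoms) qes {cert} ρ es)

  K L R S P : Polynomial 4
  K = var 0F
  L = var 1F
  R = var 2F
  S = var 3F
  P = (𝟙 :+ R) :* (𝟙 :+ S)

  N V : Polynomial 4
  N = 𝟙 :+ K :+ L
  V = K :* P :+ (K :+ R :* S) :* L

  parameters : Rank3TA ℝ → Vec Carrier 4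
  parameters A = k ∷ ℓ ∷ r ∷ s ∷ []
    where open Rank3TA A

  unitᵖ : Fin 3 → Fin 3 → Polynomial 4
  unitᵖ j h = if ⌊ j ≟ᶠ h ⌋ then 𝟙 else 𝟘

  λᵖ : Fin 3 → Fin 3 → Fin 3 → Polynomial 4
  λᵖ 0F j  h = unitᵖ j h
  λᵖ 1F 0F h = unitᵖ 1F h
  λᵖ 2F 0F h = unitᵖ 2F h
  λᵖ 1F 1F h = lookup (K ∷ K :+ R :* S :+ R :+ S ∷ K :+ R :* S ∷ []) h
  λᵖ 1F 2F h = lookup (𝟘 ∷ :- P ∷ :- (R :* S) ∷ []) h
  λᵖ 2F 1F h = lookup (𝟘 ∷ :- P ∷ :- (R :* S) ∷ []) h
  λᵖ 2F 2F h = lookup (L ∷ L :+ P ∷ L :+ R :* S :- 𝟙 ∷ []) h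

  χᵖ : ∀ {n} → Polynomial n → Fin 3 → Polynomial n
  χᵖ t = lookup (𝟙 ∷ t ∷ :- 𝟙 :+ :- t ∷ [])

  -- Two characters with distinct values r ≠ s at A₁ determine the A₁- and
  -- A₂-coefficients x, y of a product whose A₀-coefficient κ is known:
  -- the two character equations differ by (x - y)(r - s).
  pinned : ∀ {κ x y r s u v} m → r ≢ s →
           u ≡ κ * 1# + (x * r + (y * (- 1# + - r) + 0#)) →
           v ≡ κ * 1# + (x * s + (y * (- 1# + - s) + 0#)) →
           u - v ≡ m * (r - s) →
           x ≡ κ + m * r - u + m × y ≡ κ + m * r - u
  pinned {κ} {x} {y} {r} {s} {u} {v} m r≢s u≡ v≡ u-v≡ =
    x∙y⁻¹≈ε⇒x≈y _ _ x≡ , x∙y⁻¹≈ε⇒x≈y _ _ y≡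
    where
    ρ : Vec Carrier 8
    ρ = κ ∷ x ∷ y ∷ r ∷ s ∷ u ∷ v ∷ m ∷ []
    Κ′ X′ Y′ R′ S′ U′ V′ M′ : Polynomial 8
    Κ′ = var 0F ; X′ = var 1F ; Y′ = var 2F ; R′ = var 3F
    S′ = var 4F ; U′ = var 5F ; V′ = var 6F ; M′ = var 7F
    character : Polynomial 8 → Polynomial 8
    character t = Κ′ :* 𝟙 :+ (X′ :* t :+ (Y′ :* (:- 𝟙 :+ :- t) :+ 𝟘))
    x-y≡m : Vanishes ρ (X′ :- Y′ :- M′)
    x-y≡m = *-cancelˡ-≡0 (r≢s ∘ x∙y⁻¹≈ε⇒x≈y r s)
      (vanishes-by ((R′ :- S′) :* (X′ :- Y′ :- M′))
        ((:- 𝟙 , U′ :- character R′) ∷ (𝟙 , V′ :- character S′) ∷ (𝟙 , U′ :- V′ :- M′ :* (R′ :- S′)) ∷ [])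
        ρ
        (x≈y⇒x∙y⁻¹≈ε u≡ ∷ x≈y⇒x∙y⁻¹≈ε v≡ ∷ x≈y⇒x∙y⁻¹≈ε u-v≡ ∷ []))
    y≡ : Vanishes ρ (Y′ :- (Κ′ :+ M′ :* R′ :- U′))
    y≡ = vanishes-by (Y′ :- (Κ′ :+ M′ :* R′ :- U′))
           ((𝟙 , U′ :- character R′) ∷ (R′ , X′ :- Y′ :- M′) ∷ []) ρ
           (x≈y⇒x∙y⁻¹≈ε u≡ ∷ x-y≡m ∷ [])
    x≡ : Vanishes ρ (X′ :- (Κ′ :+ M′ :* R′ :- U′ :+ M′))
    x≡ = vanishes-by (X′ :- (Κ′ :+ M′ :* R′ :- U′ :+ M′))
           ((𝟙 , X′ :- Y′ :- M′) ∷ (𝟙 , Y′ :- (Κ′ :+ M′ :* R′ :- U′)) ∷ []) ρ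
           (x-y≡m ∷ y≡ ∷ [])

  ConditionK ConditionL : Rank3TA ℝ → Set
  ConditionK A = k ≡ r × s ≡ - 1#
    where open Rank3TA A
  ConditionL A = ℓ ≡ - 1# + - s × r ≡ 0#
    where open Rank3TA A

  module StructureConstants (A : Rank3TA ℝ) where
    open Rank3TA A

    -- κᵖ is the A₀-coefficient of A_i A_j, and mᵖ the quotient of
    -- χ_r(A_i) χ_r(A_j) - χ_s(A_i) χ_s(A_j) by r - s.
    λc-row≡λᵖ : ∀ i j (κᵖ mᵖ : Polynomial 4) → λc i j 0F ≡ ⟦ κᵖ ⟧ (parameters A) →
          ⟦ χᵖ R i :* χᵖ R j ⟧ (parameters A) ≡ sum (λ h → λc i j h * lookup (1# ∷ r ∷ (- 1# + - r) ∷ []) h) →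
          ⟦ χᵖ S i :* χᵖ S j ⟧ (parameters A) ≡ sum (λ h → λc i j h * lookup (1# ∷ s ∷ (- 1# + - s) ∷ []) h) →
          {IsIdentity (χᵖ R i :* χᵖ R j :- χᵖ S i :* χᵖ S j) (mᵖ :* (R :- S))} →
          {IsIdentity (κᵖ :+ mᵖ :* R :- χᵖ R i :* χᵖ R j :+ mᵖ) (λᵖ i j 1F)} →
          {IsIdentity (κᵖ :+ mᵖ :* R :- χᵖ R i :* χᵖ R j) (λᵖ i j 2F)} →
          ∀ h → λc i j (suc h) ≡ ⟦ λᵖ i j (suc h) ⟧ (parameters A)
    λc-row≡λᵖ i j κᵖ mᵖ κ≡ charR-ij charS-ij {diff} {x-id} {y-id} =
      finish (pinned (⟦ mᵖ ⟧ ρ) r≢s charR-ij charS-ij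
                (identity (χᵖ R i :* χᵖ R j :- χᵖ S i :* χᵖ S j) (mᵖ :* (R :- S)) {diff} ρ))
      where
      ρ : Vec Carrier 4
      ρ = parameters A
      u m : Carrier
      u = ⟦ χᵖ R i :* χᵖ R j ⟧ ρ
      m = ⟦ mᵖ ⟧ ρ
      finish : λc i j 1F ≡ λc i j 0F + m * r - u + m × λc i j 2F ≡ λc i j 0F + m * r - u →
               ∀ h → λc i j (suc h) ≡ ⟦ λᵖ i j (suc h) ⟧ (parameters A)
      finish (x≡ , _) 0F = trans x≡ (trans (cong (λ κ → κ + m * r - u + m) κ≡)
                                     (identity (κᵖ :+ mᵖ :* R :- χᵖ R i :* χᵖ R j :+ mᵖ) (λᵖ i j 1F) {x-id} ρ))
      finish (_ , y≡) 1F = trans y≡ (trans (cong (λ κ → κ + m * r - u) κ≡)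
                                     (identity (κᵖ :+ mᵖ :* R :- χᵖ R i :* χᵖ R j) (λᵖ i j 2F) {y-id} ρ))

    ⟦unitᵖ⟧ : ∀ j h → δᶠ ℝ j h ≡ ⟦ unitᵖ j h ⟧ (parameters A)
    ⟦unitᵖ⟧ j h with ⌊ j ≟ᶠ h ⌋
    ... | true  = refl
    ... | false = refl

    λc₁₂≡λᵖ₁₂ : ∀ h → λc 1F 2F h ≡ ⟦ λᵖ 1F 2F h ⟧ (parameters A)
    λc₁₂≡λᵖ₁₂ 0F      = offdiag 1F 2F λ ()
    λc₁₂≡λᵖ₁₂ (suc h) =
      λc-row≡λᵖ 1F 2F 𝟘 (:- 𝟙 :- R :- S) (offdiag 1F 2F λ ()) (proj₂ charR 1F 2F) (proj₂ charS 1F 2F) h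

    λc≡λᵖ : ∀ i j h → λc i j h ≡ ⟦ λᵖ i j h ⟧ (parameters A)
    λc≡λᵖ 0F j  h  = trans (unitˡ j h) (⟦unitᵖ⟧ j h)
    λc≡λᵖ 1F 0F h  = trans (unitʳ 1F h) (⟦unitᵖ⟧ 1F h)
    λc≡λᵖ 2F 0F h  = trans (unitʳ 2F h) (⟦unitᵖ⟧ 2F h)
    λc≡λᵖ 1F 1F 0F = refl
    λc≡λᵖ 1F 1F (suc h) =
      λc-row≡λᵖ 1F 1F K (R :+ S) refl (proj₂ charR 1F 1F) (proj₂ charS 1F 1F) h
    λc≡λᵖ 1F 2F h  = λc₁₂≡λᵖ₁₂ h
    λc≡λᵖ 2F 1F h  = trans (comm 2F 1F h) (λc₁₂≡λᵖ₁₂ h)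
    λc≡λᵖ 2F 2F 0F = refl
    λc≡λᵖ 2F 2F (suc h) =
      λc-row≡λᵖ 2F 2F L (𝟙 :+ 𝟙 :+ R :+ S) refl (proj₂ charR 2F 2F) (proj₂ charS 2F 2F) h

  open StructureConstants public

  module Constraints (A : Rank3TA ℝ) where
    open Rank3TA A

    ρA : Vec Carrier 4
    ρA = parameters A

    -- δ(A₁)² = δ(A₁ A₁) expressed in k, ℓ, r, s
    valency-relation : Vanishes ρA V
    valency-relation = vanishes-by V
      ((:- 𝟙 , K :* K :- (K :* 𝟙 :+ (λᵖ 1F 1F 1F :* K :+ (λᵖ 1F 1F 2F :* L :+ 𝟘)))) ∷ []) ρA
      (x≈y⇒x∙y⁻¹≈ε (trans (proj₂ valency 1F 1F)
        (cong₂ (λ x y → k * x + y) (unitˡ 0F 0F)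
          (cong₂ (λ x y → x * k + (y * ℓ + 0#)) (λc≡λᵖ A 1F 1F 1F) (λc≡λᵖ A 1F 1F 2F)))) ∷ [])

    valency-1≥0 : ∀ i → 0# ≤ λc i i 0F - 1#
    valency-1≥0 i with integral i
    ... | suc n , _ , λii0≡1+n = subst (0# ≤_) (sym (begin
      λc i i 0F - 1#     ≡⟨ cong (_- 1#) λii0≡1+n ⟩
      1# + fromℕ n - 1#  ≡⟨ cong (_- 1#) (+-comm 1# (fromℕ n)) ⟩
      fromℕ n + 1# - 1#  ≡⟨ //-rightDividesʳ 1# (fromℕ n) ⟩
      fromℕ n            ∎)) (fromℕ-nonneg n)

    atoms : Fin 5 → Polynomial 4
    atoms = lookup (K :- 𝟙 ∷ L :- 𝟙 ∷ λᵖ 1F 2F 1F ∷ λᵖ 1F 2F 2F ∷ R :- S ∷ [])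

    atoms-nonneg : ∀ i → 0# ≤ ⟦ atoms i ⟧ ρA
    atoms-nonneg 0F = valency-1≥0 1F
    atoms-nonneg 1F = valency-1≥0 2F
    atoms-nonneg 2F = subst (0# ≤_) (λc≡λᵖ A 1F 2F 1F) (nonneg 1F 2F 1F)
    atoms-nonneg 3F = subst (0# ≤_) (λc≡λᵖ A 1F 2F 2F) (nonneg 1F 2F 2F)
    atoms-nonneg 4F = ≤⇒0≤- s≤r

    impossible : ∀ e qes → {IsIdentity (𝟙 :+ ⟦ e ⟧⁺ atoms) (combination qes)} →
                 All (Vanishes ρA ∘ proj₂) qes → ⊥
    impossible = refute atoms-nonneg

    k≢0 : k ≢ 0#
    k≢0 k≡0 = impossible (atom 0F) ((𝟙 , K) ∷ []) (k≡0 ∷ [])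

    ℓ≢0 : ℓ ≢ 0#
    ℓ≢0 ℓ≡0 = impossible (atom 1F) ((𝟙 , L) ∷ []) (ℓ≡0 ∷ [])

    n≢0 : ⟦ N ⟧ ρA ≢ 0#
    n≢0 n≡0 = impossible (one ⊕ one ⊕ atom 0F ⊕ atom 1F) ((𝟙 , N) ∷ []) (n≡0 ∷ [])

    λ₁₁²≡0⇒K : Vanishes ρA (λᵖ 1F 1F 2F) → ConditionK A
    λ₁₁²≡0⇒K k+rs≡0 = k≡r , +-inverseʳ-unique 1# s 1+s≡0
      where
      p≡0 : Vanishes ρA P
      p≡0 = *-cancelˡ-≡0 k≢0 (vanishes-by (K :* P) ((𝟙 , V) ∷ (:- L , K :+ R :* S) ∷ []) ρA
                                (valency-relation ∷ k+rs≡0 ∷ []))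
      1+r≢0 : ¬ Vanishes ρA (𝟙 :+ R)
      1+r≢0 1+r≡0 = impossible (atom 4F ⊕ (one ⊕ atom 0F)) ((𝟙 , K :+ R :* S) ∷ (𝟙 :- S , 𝟙 :+ R) ∷ [])
                      (k+rs≡0 ∷ 1+r≡0 ∷ [])
      1+s≡0 : Vanishes ρA (𝟙 :+ S)
      1+s≡0 = *-cancelˡ-≡0 1+r≢0 p≡0
      k≡r : k ≡ r
      k≡r = x∙y⁻¹≈ε⇒x≈y k r (vanishes-by (K :- R) ((𝟙 , K :+ R :* S) ∷ (:- R , 𝟙 :+ S) ∷ []) ρA
                               (k+rs≡0 ∷ 1+s≡0 ∷ []))

    nP≡0⇒K : Vanishes ρA (N :* P) → ConditionK A
    nP≡0⇒K np≡0 = λ₁₁²≡0⇒K (*-cancelˡ-≡0 ℓ≢0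
      (vanishes-by (L :* (K :+ R :* S)) ((𝟙 , V) ∷ (:- K , P) ∷ []) ρA
                   (valency-relation ∷ *-cancelˡ-≡0 n≢0 np≡0 ∷ [])))

    λ₂₂¹≡0⇒L : Vanishes ρA (λᵖ 2F 2F 1F) → ConditionL A
    λ₂₂¹≡0⇒L ℓ+p≡0 = ℓ≡-1-s , r≡0
      where
      rs≡0 : Vanishes ρA (R :* S)
      rs≡0 = *-cancelˡ-≡0 ℓ≢0 (vanishes-by (L :* (R :* S)) ((𝟙 , V) ∷ (:- K , L :+ P) ∷ []) ρA
                                 (valency-relation ∷ ℓ+p≡0 ∷ []))
      s≢0 : s ≢ 0#
      s≢0 s≡0 = impossible (atom 1F ⊕ (one ⊕ atom 4F)) ((𝟙 , L :+ P) ∷ (:- (𝟙 :+ 𝟙 :+ R) , S) ∷ [])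
                  (ℓ+p≡0 ∷ s≡0 ∷ [])
      r≡0 : r ≡ 0#
      r≡0 = *-cancelˡ-≡0 s≢0 (trans (*-comm s r) rs≡0)
      ℓ≡-1-s : ℓ ≡ - 1# + - s
      ℓ≡-1-s = trans (+-inverseʳ-unique (1# + s) ℓ
                       (vanishes-by (𝟙 :+ S :+ L) ((𝟙 , L :+ P) ∷ (:- (𝟙 :+ S) , R) ∷ []) ρA
                                    (ℓ+p≡0 ∷ r≡0 ∷ [])))
                     (sym (-‿+-comm 1# s))

    nrs≡0⇒L : Vanishes ρA (N :* (R :* S)) → ConditionL A
    nrs≡0⇒L nrs≡0 = λ₂₂¹≡0⇒L (*-cancelˡ-≡0 k≢0
      (vanishes-by (K :* (L :+ P)) ((𝟙 , V) ∷ (:- L , R :* S) ∷ []) ρA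
                   (valency-relation ∷ *-cancelˡ-≡0 n≢0 nrs≡0 ∷ [])))

    ¬[K×L] : ConditionK A → ConditionL A → ⊥
    ¬[K×L] (k≡r , _) (_ , r≡0) = k≢0 (trans k≡r r≡0)

    k-rs[k+ℓ]≢0 : ¬ Vanishes ρA (K :- R :* S :* (K :+ L))
    k-rs[k+ℓ]≢0 h = impossible (atom 0F ⊕ atom 3F ⊗ (one ⊕ one ⊕ atom 0F ⊕ atom 1F))
                               ((𝟙 , K :- R :* S :* (K :+ L)) ∷ []) (h ∷ [])

    -- n (ℓ + P - n rs) - (nP - (k + rs)) = nℓ + k + (n² - 1)(- rs) > 0
    λ₂₂¹≡nrs⇒nP≢λ₁₁² : Vanishes ρA (λᵖ 2F 2F 1F :- N :* (R :* S)) →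
                        ¬ Vanishes ρA (N :* P :- λᵖ 1F 1F 2F)
    λ₂₂¹≡nrs⇒nP≢λ₁₁² h h′ = impossible
      (k+ℓ ⊕ n ⊗ atom 1F ⊕ (one ⊕ atom 0F) ⊕ atom 3F ⊗ k+ℓ ⊗ (n ⊕ one))
      ((N , L :+ P :- N :* (R :* S)) ∷ (:- 𝟙 , N :* P :- (K :+ R :* S)) ∷ []) (h ∷ h′ ∷ [])
      where
      k+ℓ n : Nonneg 5
      k+ℓ = one ⊕ one ⊕ atom 0F ⊕ atom 1F
      n   = one ⊕ k+ℓ

  open Constraints public

  sum-cong : ∀ {n} {f g : Fin n → Carrier} → (∀ i → f i ≡ g i) → sum f ≡ sum g
  sum-cong {ℕ.zero} f≗g = refl
  sum-cong {suc n}  f≗g = cong₂ _+_ (f≗g zero) (sum-cong (f≗g ∘ suc))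

  Σᵖ : ∀ {n m} → (Fin n → Polynomial m) → Polynomial m
  Σᵖ {ℕ.zero} f = 𝟘
  Σᵖ {suc n}  f = f zero :+ Σᵖ (f ∘ suc)

  ⟦Σᵖ⟧ : ∀ {n m} (f : Fin n → Polynomial m) ρ → ⟦ Σᵖ f ⟧ ρ ≡ sum (λ i → ⟦ f i ⟧ ρ)
  ⟦Σᵖ⟧ {ℕ.zero} f ρ = refl
  ⟦Σᵖ⟧ {suc n}  f ρ = cong (⟦ f zero ⟧ ρ +_) (⟦Σᵖ⟧ (f ∘ suc) ρ)

  μᵖ : Fin 9 → Fin 9 → Fin 9 → Polynomial 4
  μᵖ t u c = λᵖ (proj₁ (cidx ℝ t)) (proj₁ (cidx ℝ u)) (proj₁ (cidx ℝ c))
          :* λᵖ (proj₂ (cidx ℝ t)) (proj₂ (cidx ℝ u)) (proj₂ (cidx ℝ c))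

  blockProdᵖ : Partition → Fin 9 → Fin 9 → Fin 9 → Polynomial 4
  blockProdᵖ τ a b c = Σᵖ λ t → Σᵖ λ u →
    if sameBlock τ t a then (if sameBlock τ u b then μᵖ t u c else 𝟘) else 𝟘

  ⟦if⟧ : ∀ {m} (x y : Bool) (p : Polynomial m) ρ →
         ⟦ if x then (if y then p else 𝟘) else 𝟘 ⟧ ρ ≡ (if x then (if y then ⟦ p ⟧ ρ else 0#) else 0#)
  ⟦if⟧ false y     p ρ = refl
  ⟦if⟧ true  false p ρ = refl
  ⟦if⟧ true  true  p ρ = refl

  μ≡μᵖ : ∀ A t u c → μ ℝ A t u c ≡ ⟦ μᵖ t u c ⟧ (parameters A)
  μ≡μᵖ A t u c = cong₂ _*_ (λc≡λᵖ A (proj₁ (cidx ℝ t)) (proj₁ (cidx ℝ u)) (proj₁ (cidx ℝ c)))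
                           (λc≡λᵖ A (proj₂ (cidx ℝ t)) (proj₂ (cidx ℝ u)) (proj₂ (cidx ℝ c)))

  blockProdCoeff≡ : ∀ A τ a b c → blockProdCoeff ℝ A τ a b c ≡ ⟦ blockProdᵖ τ a b c ⟧ (parameters A)
  blockProdCoeff≡ A τ a b c =
    sym (trans (⟦Σᵖ⟧ (λ t → Σᵖ (term t)) ρ) (sum-cong λ t → trans (⟦Σᵖ⟧ (term t) ρ) (sum-cong λ u →
      trans (⟦if⟧ (sameBlock τ t a) (sameBlock τ u b) (μᵖ t u c) ρ)
            (cong (λ z → if sameBlock τ t a then (if sameBlock τ u b then z else 0#) else 0#)
                  (sym (μ≡μᵖ A t u c))))))
    where
    ρ : Vec Carrier 4
    ρ = parameters A
    term : Fin 9 → Fin 9 → Polynomial 4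
    term t u = if sameBlock τ t a then (if sameBlock τ u b then μᵖ t u c else 𝟘) else 𝟘

  blockProdCoeff-cong : ∀ A τ a a′ b b′ c → sameBlock τ a a′ ≡ true → sameBlock τ b b′ ≡ true →
                        blockProdCoeff ℝ A τ a b c ≡ blockProdCoeff ℝ A τ a′ b′ c
  blockProdCoeff-cong A τ a a′ b b′ c a~a′ b~b′ = sum-cong λ t → sum-cong λ u →
    cong₂ (λ x y → if x then (if y then μ ℝ A t u c else 0#) else 0#)
          (sameBlock-≡ τ a a′ a~a′ t) (sameBlock-≡ τ b b′ b~b′ u)

  -- Closure under multiplication only has to be checked for block
  -- representatives a, b, comparing each coefficient with that of the
  -- representative of its block.
  FusionCheck : ∀ {m} → (Polynomial 4 → Polynomial m) → Partition → Set
  FusionCheck f τ = ∀ a b c → rep τ a ≡ a → rep τ b ≡ b → rep τ c ≢ c →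
                    IsIdentity (f (blockProdᵖ τ a b c)) (f (blockProdᵖ τ a b (rep τ c)))

  fusionCheck? : ∀ {m} (f : Polynomial 4 → Polynomial m) τ → Dec (FusionCheck f τ)
  fusionCheck? f τ = all? λ a → all? λ b → all? λ c →
    (rep τ a ≟ᶠ a) →-dec (rep τ b ≟ᶠ b) →-dec ¬? (rep τ c ≟ᶠ c) →-dec
    T? (is-just (identity? (f (blockProdᵖ τ a b c)) (f (blockProdᵖ τ a b (rep τ c)))))

  fusion-by-check : ∀ {m} (f : Polynomial 4 → Polynomial m) τ A (ρ : Vec Carrier m) →
                    (∀ p → ⟦ p ⟧ (parameters A) ≡ ⟦ f p ⟧ ρ) → FusionCheck f τ → GivesFusion ℝ A τ
  fusion-by-check f τ A ρ f-sound check a b c c′ c~c′ = begin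
    coeff a  b  c            ≡⟨ blockProdCoeff-cong A τ a a′ b b′ c (~rep a) (~rep b) ⟩
    coeff a′ b′ c            ≡⟨ at-rep c ⟩
    coeff a′ b′ (rep τ c)    ≡⟨ cong (coeff a′ b′) (rep-cong τ c c′ c~c′) ⟩
    coeff a′ b′ (rep τ c′)   ≡⟨ at-rep c′ ⟨
    coeff a′ b′ c′           ≡⟨ blockProdCoeff-cong A τ a a′ b b′ c′ (~rep a) (~rep b) ⟨
    coeff a  b  c′           ∎
    where
    coeff : Fin 9 → Fin 9 → Fin 9 → Carrier
    coeff = blockProdCoeff ℝ A τ
    a′ b′ : Fin 9
    a′ = rep τ a
    b′ = rep τ b
    ~rep : ∀ x → sameBlock τ x (rep τ x) ≡ true
    ~rep x = sameBlock-sym τ (rep τ x) x (rep-sameBlock τ x)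
    via-f : ∀ x → coeff a′ b′ x ≡ ⟦ f (blockProdᵖ τ a′ b′ x) ⟧ ρ
    via-f x = trans (blockProdCoeff≡ A τ a′ b′ x) (f-sound (blockProdᵖ τ a′ b′ x))
    at-rep′ : ∀ x → Dec (rep τ x ≡ x) → coeff a′ b′ x ≡ coeff a′ b′ (rep τ x)
    at-rep′ x (yes rx≡x) = cong (coeff a′ b′) (sym rx≡x)
    at-rep′ x (no  rx≢x) =
      trans (via-f x) (trans (identity (f (blockProdᵖ τ a′ b′ x)) (f (blockProdᵖ τ a′ b′ (rep τ x)))
                                       {check a′ b′ x (rep-idem τ a) (rep-idem τ b) rx≢x} ρ)
                             (sym (via-f (rep τ x))))
    at-rep : ∀ x → coeff a′ b′ x ≡ coeff a′ b′ (rep τ x)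
    at-rep x = at-rep′ x (rep τ x ≟ᶠ x)

  always-fusion : ∀ τ → {True (fusionCheck? id τ)} → ∀ A → GivesFusion ℝ A τ
  always-fusion τ {check} A = fusion-by-check id τ A (parameters A) (λ _ → refl) (toWitness check)

  -- specialise r := k, s := -1 (condition K) and ℓ := -1 - s, r := 0 (condition L)
  σK σL : Vec (Polynomial 2) 4
  σK = var 0F ∷ var 1F ∷ var 0F ∷ :- 𝟙 ∷ []
  σL = var 0F ∷ :- 𝟙 :- var 1F ∷ 𝟘 ∷ var 1F ∷ []

  fusion-under-K : ∀ τ → {True (fusionCheck? (substitute σK) τ)} → ∀ A → ConditionK A → GivesFusion ℝ A τ
  fusion-under-K τ {check} A (k≡r , s≡-1) =
    fusion-by-check (substitute σK) τ A (k ∷ ℓ ∷ []) sound (toWitness check)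
    where
    open Rank3TA A
    sound : ∀ p → ⟦ p ⟧ (parameters A) ≡ ⟦ substitute σK p ⟧ (k ∷ ℓ ∷ [])
    sound p = trans (cong₂ (λ x y → ⟦ p ⟧ (k ∷ ℓ ∷ x ∷ y ∷ [])) (sym k≡r) s≡-1)
                    (sym (⟦substitute⟧ σK p (k ∷ ℓ ∷ [])))

  fusion-under-L : ∀ τ → {True (fusionCheck? (substitute σL) τ)} → ∀ A → ConditionL A → GivesFusion ℝ A τ
  fusion-under-L τ {check} A (ℓ≡-1-s , r≡0) =
    fusion-by-check (substitute σL) τ A (k ∷ s ∷ []) sound (toWitness check)
    where
    open Rank3TA A
    sound : ∀ p → ⟦ p ⟧ (parameters A) ≡ ⟦ substitute σL p ⟧ (k ∷ s ∷ [])
    sound p = trans (cong₂ (λ x y → ⟦ p ⟧ (k ∷ x ∷ y ∷ s ∷ [])) ℓ≡-1-s r≡0)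
                    (sym (⟦substitute⟧ σL p (k ∷ s ∷ [])))

  coefficient-gap : ∀ τ a b c c′ Q → {T (sameBlock τ c c′)} →
                    {IsIdentity (blockProdᵖ τ a b c :- blockProdᵖ τ a b c′) Q} →
                    ∀ A → GivesFusion ℝ A τ → Vanishes (parameters A) Q
  coefficient-gap τ a b c c′ Q {c~c′} {gap} A fusion =
    trans (sym (identity (blockProdᵖ τ a b c :- blockProdᵖ τ a b c′) Q {gap} (parameters A)))
          (x≈y⇒x∙y⁻¹≈ε (trans (sym (blockProdCoeff≡ A τ a b c))
                         (trans (fusion a b c c′ (Equivalence.to T-≡ c~c′)) (blockProdCoeff≡ A τ a b c′))))

  -- The Petersen graph srg(10, 3, 0, 1), with eigenvalues r = 1 and s = -2,
  -- satisfies neither condition K nor condition L.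
  petersen-table : Fin 3 → Fin 3 → Fin 3 → ℕ
  petersen-table 0F j  h = if ⌊ j ≟ᶠ h ⌋ then 1 else 0
  petersen-table 1F 0F h = if ⌊ 1F ≟ᶠ h ⌋ then 1 else 0
  petersen-table 2F 0F h = if ⌊ 2F ≟ᶠ h ⌋ then 1 else 0
  petersen-table 1F 1F h = lookup (3 ∷ 0 ∷ 1 ∷ []) h
  petersen-table 1F 2F h = lookup (0 ∷ 2 ∷ 2 ∷ []) h
  petersen-table 2F 1F h = lookup (0 ∷ 2 ∷ 2 ∷ []) h
  petersen-table 2F 2F h = lookup (6 ∷ 4 ∷ 3 ∷ []) h

  petersenᵖ : Fin 3 → Fin 3 → Fin 3 → Polynomial 0
  petersenᵖ i j h = con (petersen-table i j h , 0)

  ⌜⌝≡fromℕ : ∀ n → ⌜ n ⌝ ≡ fromℕ n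
  ⌜⌝≡fromℕ 0             = refl
  ⌜⌝≡fromℕ 1             = sym (+-identityʳ 1#)
  ⌜⌝≡fromℕ (suc (suc n)) = cong (1# +_) (⌜⌝≡fromℕ (suc n))

  IsCharacterᵖ : (Fin 3 → Polynomial 0) → Set
  IsCharacterᵖ χ = ∀ i j → IsIdentity (χ i :* χ j) (Σᵖ λ h → petersenᵖ i j h :* χ h)

  isCharacterᵖ? : ∀ χ → Dec (IsCharacterᵖ χ)
  isCharacterᵖ? χ = all? λ i → all? λ j →
    T? (is-just (identity? (χ i :* χ j) (Σᵖ λ h → petersenᵖ i j h :* χ h)))

  petersen-character : ∀ (v : Fin 3 → Carrier) χ → v 0F ≡ 1# → (∀ i → v i ≡ ⟦ χ i ⟧ []) →
                       {True (isCharacterᵖ? χ)} → IsCharacter ℝ (λ i j h → ⟦ petersenᵖ i j h ⟧ []) v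
  petersen-character v χ v0≡1 v≡χ {check} = v0≡1 , λ i j → begin
    v i * v j
      ≡⟨ cong₂ _*_ (v≡χ i) (v≡χ j) ⟩
    ⟦ χ i :* χ j ⟧ []
      ≡⟨ identity (χ i :* χ j) (Σᵖ λ h → petersenᵖ i j h :* χ h) {toWitness check i j} [] ⟩
    ⟦ Σᵖ (λ h → petersenᵖ i j h :* χ h) ⟧ []
      ≡⟨ ⟦Σᵖ⟧ (λ h → petersenᵖ i j h :* χ h) [] ⟩
    sum (λ h → ⟦ petersenᵖ i j h ⟧ [] * ⟦ χ h ⟧ [])
      ≡⟨ sum-cong (λ h → cong (⟦ petersenᵖ i j h ⟧ [] *_) (v≡χ h)) ⟨
    sum (λ h → ⟦ petersenᵖ i j h ⟧ [] * v h) ∎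

  Associativeᵖ : Set
  Associativeᵖ = ∀ i j m t → IsIdentity (Σᵖ λ h → petersenᵖ i j h :* petersenᵖ h m t)
                                        (Σᵖ λ h → petersenᵖ j m h :* petersenᵖ i h t)

  associativeᵖ? : Dec Associativeᵖ
  associativeᵖ? = all? λ i → all? λ j → all? λ m → all? λ t →
    T? (is-just (identity? (Σᵖ λ h → petersenᵖ i j h :* petersenᵖ h m t)
                           (Σᵖ λ h → petersenᵖ j m h :* petersenᵖ i h t)))

  petersen : Rank3TA ℝ
  petersen = record
    { λc       = λc
    ; unitˡ    = unit
    ; unitʳ    = λ { 0F h → unit 0F h ; 1F h → unit 1F h ; 2F h → unit 2F h }
    ; comm     = λ i j h → cong ⌜_⌝ (from-yes symmetric? i j h)
    ; assoc    = λ i j m t → trans (sym (⟦Σᵖ⟧ (λ h → petersenᵖ i j h :* petersenᵖ h m t) []))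
                   (trans (identity _ _ {from-yes associativeᵖ? i j m t} [])
                          (⟦Σᵖ⟧ (λ h → petersenᵖ j m h :* petersenᵖ i h t) []))
    ; nonneg   = λ i j h → subst (0# ≤_) (sym (⌜⌝≡fromℕ (petersen-table i j h)))
                                          (fromℕ-nonneg (petersen-table i j h))
    ; offdiag  = λ i j i≢j → cong ⌜_⌝ (from-yes offdiagonal? i j i≢j)
    ; integral = λ { 0F → 1 , s≤s z≤n , ⌜⌝≡fromℕ 1
                   ; 1F → 3 , s≤s z≤n , ⌜⌝≡fromℕ 3
                   ; 2F → 6 , s≤s z≤n , ⌜⌝≡fromℕ 6 }
    ; valency  = petersen-character (λ i → λc i i 0F) (λ i → petersenᵖ i i 0F) refl (λ _ → refl)
    ; r        = 1#
    ; s        = - (1# + 1#)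
    ; charR    = petersen-character _ (χᵖ 𝟙) refl (λ { 0F → refl ; 1F → refl ; 2F → refl })
    ; charS    = petersen-character _ (χᵖ (:- (𝟙 :+ 𝟙))) refl (λ { 0F → refl ; 1F → refl ; 2F → refl })
    ; s≤r      = 0≤-⇒≤ (subst (0# ≤_) (cong (1# +_) (sym (-‿involutive (1# + 1#)))) (+-nonneg 0≤1 0≤2))
    ; r≢s      = λ 1≡-2 → 1+≢0 0≤2 (trans (cong (_+ (1# + 1#)) 1≡-2) (-‿inverseˡ (1# + 1#)))
    }
    where
    λc : Fin 3 → Fin 3 → Fin 3 → Carrier
    λc i j h = ⟦ petersenᵖ i j h ⟧ []
    unit : ∀ j h → λc 0F j h ≡ δᶠ ℝ j h
    unit j h with ⌊ j ≟ᶠ h ⌋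
    ... | true  = refl
    ... | false = refl
    0≤2 : 0# ≤ 1# + 1#
    0≤2 = +-nonneg 0≤1 0≤1
    symmetric? : Dec (∀ i j h → petersen-table i j h ≡ petersen-table j i h)
    symmetric? = all? λ i → all? λ j → all? λ h → petersen-table i j h ℕ.≟ petersen-table j i h
    offdiagonal? : Dec (∀ i j → i ≢ j → petersen-table i j 0F ≡ 0)
    offdiagonal? = all? λ i → all? λ j → ¬? (i ≟ᶠ j) →-dec (petersen-table i j 0F ℕ.≟ 0)

  petersen-¬K : ¬ ConditionK petersen
  petersen-¬K (3≡1 , _) = 1+≢0 0≤1 (+-identityʳ-unique 1# (1# + 1#) 3≡1)

  petersen-¬L : ¬ ConditionL petersen
  petersen-¬L (_ , 1≡0) = 0≢1 (sym 1≡0)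

  Exception : List Partition → List Partition → Rank3TA ℝ → Partition → Set
  Exception LK LL A τ = (k ≡ r × s ≡ - 1# × τ ∈ₚ LK) ⊎ (ℓ ≡ - 1# + - s × r ≡ 0# × τ ∈ₚ LL)
    where open Rank3TA A

  Exception-map : ∀ {LK LL LK′ LL′ τ τ′} A → (τ ∈ₚ LK → τ′ ∈ₚ LK′) → (τ ∈ₚ LL → τ′ ∈ₚ LL′) →
                  Exception LK LL A τ → Exception LK′ LL′ A τ′
  Exception-map A K⇒K′ L⇒L′ = Sum.map (Product.map₂ (Product.map₂ K⇒K′)) (Product.map₂ (Product.map₂ L⇒L′))

  Verdict : List Partition → List Partition → List Partition → Partition → Set
  Verdict Lall LK LL τ =
    (((∀ A → GivesFusion ℝ A τ) → τ ∈ₚ Lall) × (τ ∈ₚ Lall → ∀ A → GivesFusion ℝ A τ)) ×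
    (¬ τ ∈ₚ Lall → ∀ A → (GivesFusion ℝ A τ → Exception LK LL A τ) ×
                         (Exception LK LL A τ → GivesFusion ℝ A τ))

  verdict-always : ∀ {Lall LK LL τ} {member : True (τ ∈ₚ? Lall)} →
                   (∀ A → GivesFusion ℝ A τ) → Verdict Lall LK LL τ
  verdict-always {member = member} fuses = ((λ _ → toWitness member) , (λ _ → fuses)) ,
                                         (λ ¬member → contradiction (toWitness member) ¬member)

  verdict-K : ∀ {Lall LK LL τ}
              {all∌τ : False (τ ∈ₚ? Lall)} {K∋τ : True (τ ∈ₚ? LK)} {L∌τ : False (τ ∈ₚ? LL)} →
              (∀ A → GivesFusion ℝ A τ → ConditionK A) → (∀ A → ConditionK A → GivesFusion ℝ A τ) →
              Verdict Lall LK LL τ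
  verdict-K {all∌τ = all∌τ} {K∋τ} {L∌τ} necessary sufficient =
    ((λ fuses → contradiction (necessary petersen (fuses petersen)) petersen-¬K) ,
     (λ all∋τ → contradiction all∋τ (toWitnessFalse all∌τ))) ,
    λ _ A → (λ fuses → let k≡r , s≡-1 = necessary A fuses in inj₁ (k≡r , s≡-1 , toWitness K∋τ)) ,
            [ (λ (k≡r , s≡-1 , _) → sufficient A (k≡r , s≡-1))
            , (λ (_ , _ , L∋τ) → contradiction L∋τ (toWitnessFalse L∌τ)) ]

  verdict-L : ∀ {Lall LK LL τ}
              {all∌τ : False (τ ∈ₚ? Lall)} {K∌τ : False (τ ∈ₚ? LK)} {L∋τ : True (τ ∈ₚ? LL)} →
              (∀ A → GivesFusion ℝ A τ → ConditionL A) → (∀ A → ConditionL A → GivesFusion ℝ A τ) →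
              Verdict Lall LK LL τ
  verdict-L {all∌τ = all∌τ} {K∌τ} {L∋τ} necessary sufficient =
    ((λ fuses → contradiction (necessary petersen (fuses petersen)) petersen-¬L) ,
     (λ all∋τ → contradiction all∋τ (toWitnessFalse all∌τ))) ,
    λ _ A → (λ fuses → let ℓ≡ , r≡0 = necessary A fuses in inj₂ (ℓ≡ , r≡0 , toWitness L∋τ)) ,
            [ (λ (_ , _ , K∋τ) → contradiction K∋τ (toWitnessFalse K∌τ))
            , (λ (ℓ≡ , r≡0 , _) → sufficient A (ℓ≡ , r≡0)) ]

  verdict-never : ∀ {Lall LK LL τ}
                  {all∌τ : False (τ ∈ₚ? Lall)} {K∌τ : False (τ ∈ₚ? LK)} {L∌τ : False (τ ∈ₚ? LL)} →
                  (∀ A → ¬ GivesFusion ℝ A τ) → Verdict Lall LK LL τ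
  verdict-never {all∌τ = all∌τ} {K∌τ} {L∌τ} never =
    ((λ fuses → contradiction (fuses petersen) (never petersen)) ,
     (λ all∋τ → contradiction all∋τ (toWitnessFalse all∌τ))) ,
    λ _ A → (λ fuses → contradiction fuses (never A)) ,
            [ (λ (_ , _ , K∋τ) → contradiction K∋τ (toWitnessFalse K∌τ))
            , (λ (_ , _ , L∋τ) → contradiction L∋τ (toWitnessFalse L∌τ)) ]

  Verdict-transfer : ∀ {Lall LK LL Lall′ LK′ LL′ τ τ′} →
                     (∀ A → GivesFusion ℝ A τ ⇔ GivesFusion ℝ A τ′) →
                     τ ∈ₚ Lall ⇔ τ′ ∈ₚ Lall′ → τ ∈ₚ LK ⇔ τ′ ∈ₚ LK′ →
                     τ ∈ₚ LL ⇔ τ′ ∈ₚ LL′ →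
                     Verdict Lall LK LL τ → Verdict Lall′ LK′ LL′ τ′
  Verdict-transfer fusion all K L ((all-fuse⇒all∋ , all∋⇒all-fuse) , exceptional) =
    ((λ all-fuse′ → to all (all-fuse⇒all∋ λ A → from (fusion A) (all-fuse′ A))) ,
     (λ all∋ A → to (fusion A) (all∋⇒all-fuse (from all all∋) A))) ,
    λ all∌ A → let fuse⇒exc , exc⇒fuse = exceptional (all∌ ∘ to all) A in
      (Exception-map A (to K) (to L) ∘ fuse⇒exc ∘ from (fusion A)) ,
      (to (fusion A) ∘ exc⇒fuse ∘ Exception-map A (from K) (from L))
    where open Equivalence

  blockProdCoeff-resp-≈ₚ : ∀ A {τ σ} → τ ≈ₚ σ → ∀ a b c →
                           blockProdCoeff ℝ A τ a b c ≡ blockProdCoeff ℝ A σ a b c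
  blockProdCoeff-resp-≈ₚ A τ≈σ a b c = sum-cong λ t → sum-cong λ u →
    cong₂ (λ x y → if x then (if y then μ ℝ A t u c else 0#) else 0#)
          (sameBlock-resp-≈ₚ τ≈σ t a) (sameBlock-resp-≈ₚ τ≈σ u b)

  GivesFusion-resp-≈ₚ : ∀ A {τ σ} → τ ≈ₚ σ → GivesFusion ℝ A τ → GivesFusion ℝ A σ
  GivesFusion-resp-≈ₚ A {τ} {σ} τ≈σ fuses a b c c′ c~c′ =
    trans (sym (blockProdCoeff-resp-≈ₚ A τ≈σ a b c))
          (trans (fuses a b c c′ (trans (sameBlock-resp-≈ₚ τ≈σ c c′) c~c′))
                 (blockProdCoeff-resp-≈ₚ A τ≈σ a b c′))

  Verdict-resp-≈ₚ : ∀ {Lall LK LL τ σ} → τ ≈ₚ σ → Verdict Lall LK LL τ → Verdict Lall LK LL σ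
  Verdict-resp-≈ₚ {Lall} {LK} {LL} {τ} {σ} τ≈σ = Verdict-transfer
    (λ A → mk⇔ (GivesFusion-resp-≈ₚ A τ≈σ) (GivesFusion-resp-≈ₚ A (≈ₚ-sym τ≈σ)))
    (∈ₚ-⇔ Lall) (∈ₚ-⇔ LK) (∈ₚ-⇔ LL)
    where
    ∈ₚ-⇔ : ∀ L → τ ∈ₚ L ⇔ σ ∈ₚ L
    ∈ₚ-⇔ L = mk⇔ (∈ₚ-resp-≈ₚ L τ≈σ) (∈ₚ-resp-≈ₚ L (≈ₚ-sym τ≈σ))

  classification : ∀ {m} base (rp : Fin (suc m) → Fin 8) (blk : Fin 8 → Fin (suc m)) Lall LK LL coarsenings →
                   (∀ x → base x ≡ base (rp (blk x))) →
                   (∀ v → (toℕ ∘ lookup v ∘ blk) ∈ₚ coarsenings) →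
                   All (Verdict Lall LK LL) coarsenings →
                   Classification ℝ base Lall LK LL
  classification base rp blk Lall LK LL coarsenings base-factors covered verdicts τ τ≥base =
    let verdict , τ≈σ = lookupAny verdicts (coarsening-cover base rp blk base-factors coarsenings covered τ τ≥base)
    in Verdict-resp-≈ₚ (≈ₚ-sym τ≈σ) verdict

  cidx-swap : ∀ t → cidx ℝ (swap⁺ t) ≡ Product.swap (cidx ℝ t)
  cidx-swap = from-yes (all? λ t → ≡-dec _≟ᶠ_ _≟ᶠ_ (cidx ℝ (swap⁺ t)) (Product.swap (cidx ℝ t)))

  μ-swap : ∀ A t u c → μ ℝ A (swap⁺ t) (swap⁺ u) (swap⁺ c) ≡ μ ℝ A t u c
  μ-swap A t u c = begin
    μ′ (cidx ℝ (swap⁺ t)) (cidx ℝ (swap⁺ u)) (cidx ℝ (swap⁺ c))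
      ≡⟨ cong₂ (λ p q → μ′ p q (cidx ℝ (swap⁺ c))) (cidx-swap t) (cidx-swap u) ⟩
    μ′ (Product.swap (cidx ℝ t)) (Product.swap (cidx ℝ u)) (cidx ℝ (swap⁺ c))
      ≡⟨ cong (μ′ (Product.swap (cidx ℝ t)) (Product.swap (cidx ℝ u))) (cidx-swap c) ⟩
    μ′ (Product.swap (cidx ℝ t)) (Product.swap (cidx ℝ u)) (Product.swap (cidx ℝ c))
      ≡⟨ *-comm (factor proj₂) (factor proj₁) ⟩
    μ ℝ A t u c ∎
    where
    open Rank3TA A
    μ′ : Fin 3 × Fin 3 → Fin 3 × Fin 3 → Fin 3 × Fin 3 → Carrier
    μ′ p q r = λc (proj₁ p) (proj₁ q) (proj₁ r) * λc (proj₂ p) (proj₂ q) (proj₂ r)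
    factor : (Fin 3 × Fin 3 → Fin 3) → Carrier
    factor π = λc (π (cidx ℝ t)) (π (cidx ℝ u)) (π (cidx ℝ c))

  sum≡Σ : ∀ {n} (f : Fin n → Carrier) → sum f ≡ Σ f
  sum≡Σ {ℕ.zero} f = refl
  sum≡Σ {suc n}  f = cong (f zero +_) (sum≡Σ (f ∘ suc))

  sum-swap : ∀ f → sum (f ∘ swap⁺) ≡ sum f
  sum-swap f = trans (sum≡Σ (f ∘ swap⁺))
                 (trans (sym (sum-permute f (permutation swap⁺ swap⁺ swap⁺-involutive swap⁺-involutive)))
                        (sym (sum≡Σ f)))

  blockProdCoeff-swap : ∀ A τ a b c →
    blockProdCoeff ℝ A (τ ∘ swap) a b c ≡ blockProdCoeff ℝ A τ (swap⁺ a) (swap⁺ b) (swap⁺ c)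
  blockProdCoeff-swap A τ a b c = begin
    sum (λ t → sum (λ u → entry (τ ∘ swap) a b c t u))
      ≡⟨ sum-cong (λ t → sum-cong (λ u → swapped t u)) ⟩
    sum (λ t → sum (λ u → entry τ a′ b′ c′ (swap⁺ t) (swap⁺ u)))
      ≡⟨ sum-cong (λ t → sum-swap (entry τ a′ b′ c′ (swap⁺ t))) ⟩
    sum (λ t → sum (λ u → entry τ a′ b′ c′ (swap⁺ t) u))
      ≡⟨ sum-swap (λ t → sum (entry τ a′ b′ c′ t)) ⟩
    sum (λ t → sum (λ u → entry τ a′ b′ c′ t u)) ∎
    where
    a′ b′ c′ : Fin 9
    a′ = swap⁺ a
    b′ = swap⁺ b
    c′ = swap⁺ c
    entry : Partition → Fin 9 → Fin 9 → Fin 9 → Fin 9 → Fin 9 → Carrier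
    entry σ a b c t u = if sameBlock σ t a then (if sameBlock σ u b then μ ℝ A t u c else 0#) else 0#
    swapped : ∀ t u → entry (τ ∘ swap) a b c t u ≡ entry τ a′ b′ c′ (swap⁺ t) (swap⁺ u)
    swapped t u = trans (cong (λ z → if sameBlock (τ ∘ swap) t a then (if sameBlock (τ ∘ swap) u b then z else 0#) else 0#)
                              (sym (μ-swap A t u c)))
                        (cong₂ (λ x y → if x then (if y then μ ℝ A (swap⁺ t) (swap⁺ u) c′ else 0#) else 0#)
                               (sameBlock-∘ τ swap t a) (sameBlock-∘ τ swap u b))

  GivesFusion-∘swap : ∀ A {τ} → GivesFusion ℝ A τ → GivesFusion ℝ A (τ ∘ swap)
  GivesFusion-∘swap A {τ} fuses a b c c′ c~c′ =
    trans (blockProdCoeff-swap A τ a b c)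
          (trans (fuses (swap⁺ a) (swap⁺ b) (swap⁺ c) (swap⁺ c′) (trans (sym (sameBlock-∘ τ swap c c′)) c~c′))
                 (sym (blockProdCoeff-swap A τ a b c′)))

  GivesFusion-swap⇔ : ∀ A τ → GivesFusion ℝ A (τ ∘ swap) ⇔ GivesFusion ℝ A τ
  GivesFusion-swap⇔ A τ = mk⇔
    (GivesFusion-resp-≈ₚ A (≗⇒≈ₚ (cong τ ∘ swap-involutive)) ∘ GivesFusion-∘swap A)
    (GivesFusion-∘swap A)

  by-symmetry : ∀ base₁ base₂ {Lall₁ LK₁ LL₁ Lall₂ LK₂ LL₂} →
                {base≈ : True (base₁ ≈ₚ? (base₂ ∘ swap))} {all : True (swapImage? Lall₁ Lall₂)}
                {K : True (swapImage? LK₁ LK₂)} {L : True (swapImage? LL₁ LL₂)} →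
                Classification ℝ base₁ Lall₁ LK₁ LL₁ → Classification ℝ base₂ Lall₂ LK₂ LL₂
  by-symmetry base₁ base₂ {base≈ = base≈} {all} {K} {L} classified τ τ≥base₂ =
    Verdict-transfer (λ A → GivesFusion-swap⇔ A τ)
      (∈ₚ-swapImage (toWitness all) τ) (∈ₚ-swapImage (toWitness K) τ) (∈ₚ-swapImage (toWitness L) τ)
      (classified (τ ∘ swap) (CoarserThan-resp-≈ₚ (toWitness base≈) (λ x y → τ≥base₂ (swap x) (swap y))))

p2456|3789 p2456|3|789 p2789|3456 p2|3789|456 : Partition
p2456|3789  = ⟪ 0 ∷ 1 ∷ 0 ∷ 0 ∷ 0 ∷ 1 ∷ 1 ∷ 1 ∷ [] ⟫
p2456|3|789 = ⟪ 0 ∷ 1 ∷ 0 ∷ 0 ∷ 0 ∷ 2 ∷ 2 ∷ 2 ∷ [] ⟫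
p2789|3456  = ⟪ 0 ∷ 1 ∷ 1 ∷ 1 ∷ 1 ∷ 0 ∷ 0 ∷ 0 ∷ [] ⟫
p2|3789|456 = ⟪ 0 ∷ 1 ∷ 2 ∷ 2 ∷ 2 ∷ 1 ∷ 1 ∷ 1 ∷ [] ⟫

coarsenings₁ : List Partition
coarsenings₁ = p2|3|456|789 ∷ p2|3|456789 ∷ p23|456|789 ∷ p23|456789 ∷ p23456789
             ∷ p2|3456789 ∷ p23456|789 ∷ p2|3456|789
             ∷ p2456789|3 ∷ p23789|456 ∷ p2789|3|456
             ∷ p2456|3789 ∷ p2456|3|789 ∷ p2789|3456 ∷ p2|3789|456 ∷ []

block₁ : Fin 8 → Fin 4
block₁ = lookup (0F ∷ 1F ∷ 2F ∷ 2F ∷ 2F ∷ 3F ∷ 3F ∷ 3F ∷ [])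

representative₁ : Fin 4 → Fin 8
representative₁ = lookup (0F ∷ 1F ∷ 2F ∷ 5F ∷ [])

covered₁ : ∀ (v : Vec (Fin 4) 4) → (toℕ ∘ lookup v ∘ block₁) ∈ₚ coarsenings₁
covered₁ (i ∷ j ∷ k ∷ l ∷ []) = from-yes
  (all? λ (a : Fin 4) → all? λ (b : Fin 4) → all? λ (c : Fin 4) → all? λ (d : Fin 4) →
     (toℕ ∘ lookup (a ∷ b ∷ c ∷ d ∷ []) ∘ block₁) ∈ₚ? coarsenings₁) i j k l

module Parts (ℝ : RealField) where
  open Fusion ℝ
  open IntegerRingSolver ℝ-ring

  -- the indices of coefficient-gap are in Fin 9, where t stands for C_{t+1}
  verdicts₁ : All (Verdict listAll₁ listK₁ listL₁) coarsenings₁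
  verdicts₁ =
    verdict-always (always-fusion p2|3|456|789) ∷
    verdict-always (always-fusion p2|3|456789) ∷
    verdict-always (always-fusion p23|456|789) ∷
    verdict-always (always-fusion p23|456789) ∷
    verdict-always (always-fusion p23456789) ∷
    verdict-K (λ A → λ₁₁²≡0⇒K A ∘ coefficient-gap p2|3456789 1F 1F 2F 3F (λᵖ 1F 1F 2F) A)
              (fusion-under-K p2|3456789) ∷
    verdict-K (λ A → nP≡0⇒K A ∘ coefficient-gap p23456|789 1F 1F 3F 1F (N :* P) A)
              (fusion-under-K p23456|789) ∷
    verdict-K (λ A → λ₁₁²≡0⇒K A ∘ coefficient-gap p2|3456|789 1F 1F 2F 3F (λᵖ 1F 1F 2F) A)
              (fusion-under-K p2|3456|789) ∷
    verdict-L (λ A → λ₂₂¹≡0⇒L A ∘ coefficient-gap p2456789|3 1F 1F 1F 3F (λᵖ 2F 2F 1F) A)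
              (fusion-under-L p2456789|3) ∷
    verdict-L (λ A → nrs≡0⇒L A ∘ coefficient-gap p23789|456 1F 1F 6F 1F (N :* (R :* S)) A)
              (fusion-under-L p23789|456) ∷
    verdict-L (λ A → λ₂₂¹≡0⇒L A ∘ coefficient-gap p2789|3|456 1F 2F 6F 1F (λᵖ 2F 2F 1F) A)
              (fusion-under-L p2789|3|456) ∷
    verdict-never (λ A → k-rs[k+ℓ]≢0 A ∘ coefficient-gap p2456|3789 1F 1F 2F 6F (K :- R :* S :* (K :+ L)) A) ∷
    verdict-never (λ A fuses → ¬[K×L] A
      (nP≡0⇒K A (coefficient-gap p2456|3|789 1F 6F 1F 3F (N :* P) A fuses))
      (λ₂₂¹≡0⇒L A (coefficient-gap p2456|3|789 1F 2F 3F 1F (λᵖ 2F 2F 1F) A fuses))) ∷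
    verdict-never (λ A fuses → λ₂₂¹≡nrs⇒nP≢λ₁₁² A
      (coefficient-gap p2789|3456 1F 1F 1F 6F (λᵖ 2F 2F 1F :- N :* (R :* S)) A fuses)
      (coefficient-gap p2789|3456 1F 1F 3F 2F (N :* P :- λᵖ 1F 1F 2F) A fuses)) ∷
    verdict-never (λ A → k-rs[k+ℓ]≢0 A ∘ coefficient-gap p2|3789|456 2F 2F 2F 6F (K :- R :* S :* (K :+ L)) A) ∷
    []

  part₁ : Classification ℝ p2|3|456|789 listAll₁ listK₁ listL₁
  part₁ = classification p2|3|456|789 representative₁ block₁ listAll₁ listK₁ listL₁ coarsenings₁
            (from-yes (all? λ x → p2|3|456|789 x ℕ.≟ p2|3|456|789 (representative₁ (block₁ x))))
            covered₁ verdicts₁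

  part₂ : Classification ℝ p258|369|4|7 listAll₂ listK₂ listL₂
  part₂ = by-symmetry p2|3|456|789 p258|369|4|7 part₁

theorem3p1 : (ℝ : RealField) →
    Classification ℝ p2|3|456|789 listAll₁ listK₁ listL₁ ×
    Classification ℝ p258|369|4|7 listAll₂ listK₂ listL₂
theorem3p1 ℝ = part₁ , part₂
  where open Parts ℝ
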